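{- Let $n \geq 1$. Then \[ \mathcal{S}_{(n,n)}(x) = \binom{2n}{n}^{ -1} \sum_{k=0}^{n} \binom{2n}{k} (-1)^{n-k} x^k, \] and these polynomials obey the recurrence \[ 2\mathcal{S}_{(n+1,n+1)}(x) = \frac{n+1}{2n+1} (x-1) \left( x^{n+1} - (x-1) \mathcal{S}_{(n,n)}(x)\right) + x^{n+1} \] with $\mathcal{S}_{(1,1)}(x) = x - \frac{1}{2}$. For every $\ell \in \mathbb{Z}$ we have $\mathcal{S}_{(n,n)}(\ell) \notin \mathbb{Z}$; more precisely, \[ \operatorname{ord}_2(\operatorname{denom}(\mathcal{S}_{(n,n)}(\ell))) = \begin{cases} 1, & \text{if $\ell$ is odd},\\ s_2(n), & \text{if $\ell$ is even}. \end{cases} \]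
   Context: For integers $n, r \geq 0$, $\mathcal{S}_{(r,n)}(x) = \sum_{k=0}^{n} \binom{n}{k} (-1)^k x^{n-k} \binom{r+k}{r}^{ -1} \in \mathbb{Q}[x]$. $\operatorname{denom}(q)$ is the denominator of a rational $q$ in lowest terms, $\operatorname{ord}_2$ is the $2$-adic valuation, and $s_2(n)$ is the sum of the binary digits of $n$. -}

module Defs where

open import Data.Nat as ℕ using (ℕ; zero; suc; _∸_)
open import Data.Nat.DivMod using (_%_; _/_)
open import Data.Nat.Divisibility using (_∣_)
open import Data.Nat.Combinatorics using (_C_)
open import Data.Integer as ℤ using (ℤ; +_; -[1+_])
open import Data.Rational as ℚ using (ℚ; 0ℚ; 1ℚ)
open import Data.List using (List; []; _∷_; replicate; _++_; foldr)
open import Data.Product using (_×_)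
open import Relation.Binary.PropositionalEquality using (_≡_)
open import Relation.Nullary using (¬_)

ℤ→ℚ : ℤ → ℚ
ℤ→ℚ z = z ℚ./ 1

ℕ→ℚ : ℕ → ℚ
ℕ→ℚ m = ℤ→ℚ (+ m)

-- inverse of a natural number as a rational; only ever applied to
-- binomial coefficients binom(r+k, r) ≥ 1, so the value at 0 is irrelevant
invℕ : ℕ → ℚ
invℕ zero    = 0ℚ
invℕ (suc m) = (+ 1) ℚ./ suc m

sgn : ℕ → ℚ
sgn zero          = 1ℚ
sgn (suc zero)    = ℚ.- 1ℚ
sgn (suc (suc k)) = sgn k

-- Polynomials in ℚ[x] as coefficient lists (constant term first).
-- Two polynomials are equal iff all their coefficients agree.

Poly : Set
Poly = List ℚ

coeff : Poly → ℕ → ℚ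
coeff []       _       = 0ℚ
coeff (a ∷ p)  zero    = a
coeff (a ∷ p)  (suc j) = coeff p j

infix 4 _≈ₚ_
_≈ₚ_ : Poly → Poly → Set
p ≈ₚ q = ∀ j → coeff p j ≡ coeff q j

infixl 6 _+ₚ_ _-ₚ_
infixl 7 _*ₚ_ _·ₚ_

_+ₚ_ : Poly → Poly → Poly
[]      +ₚ q       = q
(a ∷ p) +ₚ []      = a ∷ p
(a ∷ p) +ₚ (b ∷ q) = (a ℚ.+ b) ∷ (p +ₚ q)

_·ₚ_ : ℚ → Poly → Poly
c ·ₚ []      = []
c ·ₚ (a ∷ p) = (c ℚ.* a) ∷ (c ·ₚ p)

_-ₚ_ : Poly → Poly → Poly
p -ₚ q = p +ₚ ((ℚ.- 1ℚ) ·ₚ q)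

mulX : Poly → Poly
mulX p = 0ℚ ∷ p

_*ₚ_ : Poly → Poly → Poly
p *ₚ q = foldr (λ a acc → (a ·ₚ q) +ₚ mulX acc) [] p

mon : ℚ → ℕ → Poly
mon c j = replicate j 0ℚ ++ (c ∷ [])

constP : ℚ → Poly
constP c = c ∷ []

X : Poly
X = mon 1ℚ 1

Xpow : ℕ → Poly
Xpow j = mon 1ℚ j

eval : Poly → ℚ → ℚ
eval p x = foldr (λ a acc → a ℚ.+ x ℚ.* acc) 0ℚ p

sumP : (ℕ → Poly) → ℕ → Poly
sumP f zero    = []
sumP f (suc m) = sumP f m +ₚ f m

𝒮 : ℕ → ℕ → Poly
𝒮 r n = sumP (λ k → mon (ℕ→ℚ (n C k) ℚ.* sgn k ℚ.* invℕ ((r ℕ.+ k) C r)) (n ∸ k)) (suc n)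

denom : ℚ → ℕ
denom q = ℚ.↧ₙ q

Ord₂ : ℕ → ℕ → Set
Ord₂ m v = (2 ℕ.^ v ∣ m) × ¬ (2 ℕ.^ suc v ∣ m)

-- sum of binary digits (fuel ≥ number of digits)
s₂-aux : ℕ → ℕ → ℕ
s₂-aux zero     _ = 0
s₂-aux (suc f)  m = m % 2 ℕ.+ s₂-aux f (m / 2)

s₂ : ℕ → ℕ
s₂ m = s₂-aux m m

-- Coefficientwise, binom(n,k)/binom(n+k,n) = binom(2n,n-k)/binom(2n,n), which is the closed form.
-- In it, the coefficients of (x-1)²·S_{n,n} are second differences of the alternating row
-- binom(2n,·), which Pascal's rule turns into the row binom(2n+2,·): this is the recurrence.
-- The recurrence then carries 2-adic information from n to n + 1. For odd ℓ, x - 1 = 2K and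
-- 2·S_{n,n}(ℓ) stays a 2-adic unit. For even ℓ, 2^{s₂ n}·S_{n,n}(ℓ) stays a 2-adic unit, since
-- ord₂(n+1) = s₂ n + 1 - s₂(n+1) exactly absorbs the factor (n+1)/(2(2n+1)). Finally, if 2^e·q is
-- a 2-adic unit then ord₂(denom q) = e, and q is not an integer when e ≥ 1.
module Submission where

open import Defs
open import Data.Integer as ℤ using (ℤ; +_; -[1+_])
import Data.Integer.DivMod as ℤM
open import Data.Integer.Divisibility as ℤD using ()
import Data.Integer.Divisibility.Signed as ℤS
import Data.Integer.Properties as ℤP
open import Data.List using ([]; _∷_)
open import Data.Maybe using (Maybe; just; nothing)
open import Data.Nat as ℕ using (ℕ; zero; suc; _∸_; _≤_; _<_; z≤n; s≤s; NonZero)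
open import Data.Nat.Combinatorics using (_C_; k![n∸k]!∣n!; nCk≡n!/k![n-k]!; k>n⇒nCk≡0; nCk≡nC[n∸k]; nCk+nC[k+1]≡[n+1]C[k+1])
open import Data.Nat.Coprimality using (Coprime; recompute)
open import Data.Nat.Divisibility as ℕD using (_∣_; _∣?_; divides)
open import Data.Nat.Primality using (euclidsLemma; prime[2])
import Data.Nat.Properties as ℕP
import Data.Nat.Tactic.RingSolver as ℕRing
open import Data.Product using (∃; _×_; _,_; proj₁; proj₂)
open import Data.Sum using (_⊎_; inj₁; inj₂)
open import Function using (_∘_)
open import Relation.Binary.Definitions using (Tri; tri<; tri≈; tri>)
open import Relation.Binary.PropositionalEquality
open import Relation.Nullary using (¬_; Dec; yes; no; contradiction)
open import Tactic.RingSolver.Core.AlmostCommutativeRing using (AlmostCommutativeRing; fromCommutativeRing)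

-- Binomial coefficients

module _ where

  open import Data.Nat using (_+_; _*_; _!; ≢-nonZero⁻¹)
  open import Data.Nat.Properties
  open import Data.Nat.DivMod using (_/_; m/n*n≡m)
  open import Data.Nat.Tactic.RingSolver using (solve-∀)

  nCk*k!*[n∸k]!≡n! : ∀ {n k} → k ≤ n → (n C k) * (k ! * (n ∸ k) !) ≡ n !
  nCk*k!*[n∸k]!≡n! {n} {k} k≤n = begin
    (n C k) * (k ! * (n ∸ k) !)                   ≡⟨ cong (_* (k ! * (n ∸ k) !)) (nCk≡n!/k![n-k]! k≤n) ⟩
    (n ! / (k ! * (n ∸ k) !)) * (k ! * (n ∸ k) !) ≡⟨ m/n*n≡m (k![n∸k]!∣n! k≤n) ⟩
    n !                                           ∎
    where
    open ≡-Reasoning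
    instance _ = k !* (n ∸ k) !≢0

  m+r≡n⇒nCm*m!*r!≡n! : ∀ m r {n} → m + r ≡ n → (n C m) * (m ! * r !) ≡ n !
  m+r≡n⇒nCm*m!*r!≡n! m r refl = subst (λ i → ((m + r) C m) * (m ! * i !) ≡ (m + r) !) (m+n∸m≡n m r) (nCk*k!*[n∸k]!≡n! (m≤m+n m r))

  nCk≢0 : ∀ {n k} → k ≤ n → NonZero (n C k)
  nCk≢0 {n} {k} k≤n with n C k | nCk*k!*[n∸k]!≡n! k≤n
  ... | zero  | 0≡n! = contradiction (sym 0≡n!) (≢-nonZero⁻¹ (n !) {{n !≢0}})
  ... | suc _ | _    = _

  -- Cancelling M = a! b! c! (a+b)! (b+c)!, both sides become (a+b+c)! (a+b)! (b+c)!.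
  [a+b+c]C[a+b]*[a+b]Ca≡[a+b+c]Ca*[b+c]Cb : ∀ a b c →
    ((a + b + c) C (a + b)) * ((a + b) C a) ≡ ((a + b + c) C a) * ((b + c) C b)
  [a+b+c]C[a+b]*[a+b]Ca≡[a+b+c]Ca*[b+c]Cb a b c = *-cancelʳ-≡ _ _ M {{M≢0}} (begin
    (L₁ * L₂) * M                                             ≡⟨ regroup L₁ L₂ (a !) (b !) (c !) ((a + b) !) ((b + c) !) ⟩
    (L₁ * ((a + b) ! * c !)) * (L₂ * (a ! * b !)) * (b + c) ! ≡⟨ cong₂ (λ u v → u * v * (b + c) !) (m+r≡n⇒nCm*m!*r!≡n! (a + b) c refl) (m+r≡n⇒nCm*m!*r!≡n! a b refl) ⟩
    (a + b + c) ! * (a + b) ! * (b + c) !                     ≡⟨ cong₂ (λ u v → u * (a + b) ! * v) (m+r≡n⇒nCm*m!*r!≡n! a (b + c) (sym (+-assoc a b c))) (m+r≡n⇒nCm*m!*r!≡n! b c refl) ⟨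
    (R₁ * (a ! * (b + c) !)) * (a + b) ! * (R₂ * (b ! * c !)) ≡⟨ regroup′ R₁ R₂ (a !) (b !) (c !) ((a + b) !) ((b + c) !) ⟩
    (R₁ * R₂) * M                                             ∎)
    where
    open ≡-Reasoning
    L₁ = (a + b + c) C (a + b)
    L₂ = (a + b) C a
    R₁ = (a + b + c) C a
    R₂ = (b + c) C b
    M = a ! * b ! * c ! * (a + b) ! * (b + c) !
    M≢0 : NonZero M
    M≢0 = m*n≢0 _ _ {{m*n≢0 _ _ {{m*n≢0 _ _ {{m*n≢0 _ _ {{a !≢0}} {{b !≢0}}}} {{c !≢0}}}} {{(a + b) !≢0}}}} {{(b + c) !≢0}}
    regroup : ∀ l₁ l₂ a! b! c! ab! bc! → (l₁ * l₂) * (a! * b! * c! * ab! * bc!) ≡ (l₁ * (ab! * c!)) * (l₂ * (a! * b!)) * bc!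
    regroup = solve-∀
    regroup′ : ∀ r₁ r₂ a! b! c! ab! bc! → (r₁ * (a! * bc!)) * ab! * (r₂ * (b! * c!)) ≡ (r₁ * r₂) * (a! * b! * c! * ab! * bc!)
    regroup′ = solve-∀

  [1+k]*[1+n]C[1+k]≡[1+n]*nCk : ∀ n k → suc k * (suc n C suc k) ≡ suc n * (n C k)
  [1+k]*[1+n]C[1+k]≡[1+n]*nCk n k with k ≤? n
  ... | no k≰n = begin
    suc k * (suc n C suc k) ≡⟨ cong (suc k *_) (k>n⇒nCk≡0 (s≤s (≰⇒> k≰n))) ⟩
    suc k * 0               ≡⟨ *-zeroʳ (suc k) ⟩
    0                       ≡⟨ *-zeroʳ (suc n) ⟨
    suc n * 0               ≡⟨ cong (suc n *_) (k>n⇒nCk≡0 (≰⇒> k≰n)) ⟨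
    suc n * (n C k)         ∎
    where open ≡-Reasoning
  ... | yes k≤n = *-cancelʳ-≡ _ _ (k ! * d !) {{m*n≢0 _ _ {{k !≢0}} {{d !≢0}}}} (begin
    suc k * (suc n C suc k) * (k ! * d !) ≡⟨ regroup (suc k) (suc n C suc k) (k !) (d !) ⟩
    (suc n C suc k) * (suc k ! * d !)     ≡⟨ m+r≡n⇒nCm*m!*r!≡n! (suc k) d (cong suc (m+[n∸m]≡n k≤n)) ⟩
    suc n * n !                           ≡⟨ cong (suc n *_) (m+r≡n⇒nCm*m!*r!≡n! k d (m+[n∸m]≡n k≤n)) ⟨
    suc n * ((n C k) * (k ! * d !))       ≡⟨ *-assoc (suc n) (n C k) (k ! * d !) ⟨
    suc n * (n C k) * (k ! * d !)         ∎)
    where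
    open ≡-Reasoning
    d = n ∸ k
    regroup : ∀ k₁ c k! d! → k₁ * c * (k! * d!) ≡ c * ((k₁ * k!) * d!)
    regroup = solve-∀

  central : ℕ → ℕ
  central n = (2 * n) C n

  central≢0 : ∀ n → NonZero (central n)
  central≢0 n = nCk≢0 (m≤n*m n 2)

  central-ratio : ∀ {n j} → j ≤ n → (n C (n ∸ j)) * central n ≡ ((2 * n) C j) * ((n + (n ∸ j)) C n)
  central-ratio {n} {j} j≤n = begin
    (n C k) * ((2 * n) C n)                 ≡⟨ cong₂ (λ u v → (u C k) * (v C n)) (sym k+j≡n) (sym n+k+j≡2n) ⟩
    ((k + j) C k) * ((n + k + j) C n)       ≡⟨ *-comm ((k + j) C k) _ ⟩
    ((n + k + j) C n) * ((k + j) C k)       ≡⟨ [a+b+c]C[a+b]*[a+b]Ca≡[a+b+c]Ca*[b+c]Cb n k j ⟨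
    ((n + k + j) C (n + k)) * ((n + k) C n) ≡⟨ cong (λ u → (u C (n + k)) * ((n + k) C n)) n+k+j≡2n ⟩
    ((2 * n) C (n + k)) * ((n + k) C n)     ≡⟨ cong (λ u → u * ((n + k) C n)) symmetric ⟨
    ((2 * n) C j) * ((n + k) C n)           ∎
    where
    open ≡-Reasoning
    k = n ∸ j
    k+j≡n : k + j ≡ n
    k+j≡n = m∸n+n≡m j≤n
    n+k+j≡2n : n + k + j ≡ 2 * n
    n+k+j≡2n = trans (+-assoc n k j) (cong (λ m → n + m) (trans k+j≡n (sym (+-identityʳ n))))
    symmetric : (2 * n) C j ≡ (2 * n) C (n + k)
    symmetric = trans (nCk≡nC[n∸k] (≤-trans j≤n (m≤n*m n 2)))
                      (cong ((2 * n) C_) (trans (cong (_∸ j) (sym n+k+j≡2n)) (m+n∸n≡m (n + k) j)))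

  2[1+n]≡2+2n : ∀ n → 2 * suc n ≡ suc (suc (2 * n))
  2[1+n]≡2+2n = solve-∀

  [1+2n]Cn≡[1+2n]C[1+n] : ∀ n → suc (2 * n) C n ≡ suc (2 * n) C suc n
  [1+2n]Cn≡[1+2n]C[1+n] n = trans (nCk≡nC[n∸k] (m≤n⇒m≤1+n (m≤n*m n 2))) (cong (suc (2 * n) C_) 1+2n∸n≡1+n)
    where
    1+2n∸n≡1+n : suc (2 * n) ∸ n ≡ suc n
    1+2n∸n≡1+n = trans (+-∸-assoc 1 (m≤n*m n 2)) (cong suc (trans (m+n∸m≡n n (n + 0)) (+-identityʳ n)))

  [1+n]*[1+2n]Cn≡[1+2n]*central : ∀ n → suc n * (suc (2 * n) C n) ≡ suc (2 * n) * central n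
  [1+n]*[1+2n]Cn≡[1+2n]*central n =
    trans (cong (suc n *_) ([1+2n]Cn≡[1+2n]C[1+n] n)) ([1+k]*[1+n]C[1+k]≡[1+n]*nCk (2 * n) n)

  [1+n]*central[1+n]≡2[1+2n]*central : ∀ n → suc n * central (suc n) ≡ 2 * suc (2 * n) * central n
  [1+n]*central[1+n]≡2[1+2n]*central n = begin
    suc n * ((2 * suc n) C suc n)       ≡⟨ cong (λ m → suc n * (m C suc n)) (2[1+n]≡2+2n n) ⟩
    suc n * (suc (suc (2 * n)) C suc n) ≡⟨ cong (suc n *_) (nCk+nC[k+1]≡[n+1]C[k+1] (suc (2 * n)) n) ⟨
    suc n * (c + suc (2 * n) C suc n)   ≡⟨ cong (λ m → suc n * (c + m)) ([1+2n]Cn≡[1+2n]C[1+n] n) ⟨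
    suc n * (c + c)                     ≡⟨ regroup (suc n) c ⟩
    2 * (suc n * c)                     ≡⟨ cong (2 *_) ([1+n]*[1+2n]Cn≡[1+2n]*central n) ⟩
    2 * (suc (2 * n) * central n)       ≡⟨ *-assoc 2 (suc (2 * n)) (central n) ⟨
    2 * suc (2 * n) * central n         ∎
    where
    open ≡-Reasoning
    c = suc (2 * n) C n
    regroup : ∀ a c → a * (c + c) ≡ 2 * (a * c)
    regroup = solve-∀

-- Odd numbers and 2-adic valuations

module _ where

  open import Data.Nat using (_*_; _^_)
  open import Data.Nat.Properties
  open import Data.Nat.Divisibility using (1∣_; ∣-trans; ∣1⇒≡1; ∣m+n∣m⇒∣n; m∣m*n; n∣m*n; ∣n⇒∣m*n; *-monoʳ-∣; *-cancelˡ-∣)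
  open import Data.Nat.Tactic.RingSolver using (solve-∀)

  Odd : ℕ → Set
  Odd m = ¬ 2 ∣ m

  odd-1+k*2 : ∀ k → Odd (suc (k * 2))
  odd-1+k*2 k 2∣1+k*2 with ∣1⇒≡1 (∣m+n∣m⇒∣n (subst (2 ∣_) (+-comm 1 (k * 2)) 2∣1+k*2) (n∣m*n k))
  ... | ()

  odd-1 : Odd 1
  odd-1 = odd-1+k*2 0

  odd-* : ∀ {m n} → Odd m → Odd n → Odd (m * n)
  odd-* {m} {n} odd-m odd-n 2∣mn with euclidsLemma m n prime[2] 2∣mn
  ... | inj₁ 2∣m = odd-m 2∣m
  ... | inj₂ 2∣n = odd-n 2∣n

  odd⇒nonZero : ∀ {m} → Odd m → NonZero m
  odd⇒nonZero {zero}  odd-0 = contradiction (divides 0 refl) odd-0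
  odd⇒nonZero {suc m} _     = _

  odd-∣*∣ : ∀ {a b} → Odd ℤ.∣ a ∣ → Odd ℤ.∣ b ∣ → Odd ℤ.∣ a ℤ.* b ∣
  odd-∣*∣ {a} {b} odd-a odd-b = subst Odd (sym (ℤP.abs-* a b)) (odd-* {ℤ.∣ a ∣} {ℤ.∣ b ∣} odd-a odd-b)

  odd-∣-∣ : ∀ {a} → Odd ℤ.∣ a ∣ → Odd ℤ.∣ ℤ.- a ∣
  odd-∣-∣ {a} = subst Odd (sym (ℤP.∣-i∣≡∣i∣ a))

  odd-∣+2*∣ : ∀ {a} → Odd ℤ.∣ a ∣ → ∀ k → Odd ℤ.∣ a ℤ.+ + 2 ℤ.* k ∣
  odd-∣+2*∣ {a} odd-a k 2∣a+2k = odd-a (ℤS.∣⇒∣ᵤ {+ 2} {a} (ℤS.∣m+n∣n⇒∣m {+ 2} {a} (ℤS.∣ᵤ⇒∣ {+ 2} {a ℤ.+ + 2 ℤ.* k} 2∣a+2k) (ℤS.divides k (ℤP.*-comm (+ 2) k))))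

  odd-2n+1 : ∀ n → Odd (suc (2 * n))
  odd-2n+1 n = subst (λ m → Odd (suc m)) (*-comm n 2) (odd-1+k*2 n)

  2^e∣a*m⇒2^e∣m : ∀ e {a m} → Odd a → 2 ^ e ∣ a * m → 2 ^ e ∣ m
  2^e∣a*m⇒2^e∣m zero    _     _ = 1∣ _
  2^e∣a*m⇒2^e∣m (suc e) {a} {m} odd-a 2^[1+e]∣am with euclidsLemma a m prime[2] (∣-trans (m∣m*n (2 ^ e)) 2^[1+e]∣am)
  ... | inj₁ 2∣a            = contradiction 2∣a odd-a
  ... | inj₂ (divides k refl) = subst (2 ^ suc e ∣_) (*-comm 2 k) (*-monoʳ-∣ 2 (2^e∣a*m⇒2^e∣m e odd-a 2^e∣ak))
    where
    2^e∣ak : 2 ^ e ∣ a * k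
    2^e∣ak = *-cancelˡ-∣ 2 (subst (2 ^ suc e ∣_) (regroup a k) 2^[1+e]∣am)
      where
      regroup : ∀ a k → a * (k * 2) ≡ 2 * (a * k)
      regroup = solve-∀

  Ord₂-from-cross : ∀ e {a d N D} → Odd a → Odd d → 2 ^ e * N * d ≡ a * D → Coprime N D → Ord₂ D e
  Ord₂-from-cross e {a} {d} {N} {D} odd-a odd-d eq coprime = 2^e∣D , 2^[1+e]∤D
    where
    2^e∣D : 2 ^ e ∣ D
    2^e∣D = 2^e∣a*m⇒2^e∣m e odd-a (divides (N * d) (trans (sym eq) (regroup (2 ^ e) N d)))
      where
      regroup : ∀ p N d → p * N * d ≡ N * d * p
      regroup = solve-∀
    2^[1+e]∤D : ¬ 2 ^ suc e ∣ D
    2^[1+e]∤D (divides t refl) = contradiction (coprime (2∣N , ∣n⇒∣m*n t (m∣m*n (2 ^ e)))) λ ()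
      where
      instance _ = m^n≢0 2 e
      Nd≡2at : N * d ≡ 2 * (a * t)
      Nd≡2at = *-cancelˡ-≡ (N * d) (2 * (a * t)) (2 ^ e) (trans (sym (*-assoc (2 ^ e) N d)) (trans eq (regroup a t (2 ^ e))))
        where
        regroup : ∀ a t p → a * (t * (2 * p)) ≡ p * (2 * (a * t))
        regroup = solve-∀
      2∣N : 2 ∣ N
      2∣N with euclidsLemma N d prime[2] (divides (a * t) (trans Nd≡2at (*-comm 2 (a * t))))
      ... | inj₁ 2∣N = 2∣N
      ... | inj₂ 2∣d = contradiction 2∣d odd-d

-- Binary digit sums

module _ where

  open import Data.Nat using (_+_; _*_; _^_)
  open import Data.Nat.Properties
  open import Data.Nat.DivMod using (_%_; _/_; [m+kn]%n≡m%n; m*n%n≡0; m*n/n≡m; +-distrib-/; m/n<m)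
  open import Data.Nat.Induction using (<-wellFounded; Acc; acc)
  open import Data.Nat.Tactic.RingSolver using (solve-∀)

  parity : ∀ n → ∃ λ k → n ≡ k * 2 ⊎ n ≡ suc (k * 2)
  parity zero    = 0 , inj₁ refl
  parity (suc n) with parity n
  ... | k , inj₁ n≡2k   = k , inj₂ (cong suc n≡2k)
  ... | k , inj₂ n≡1+2k = suc k , inj₁ (cong suc n≡1+2k)

  binary-induction : (P : ℕ → Set) → P 0 → (∀ k → P k → P (k * 2)) → (∀ k → P k → P (suc (k * 2))) → ∀ n → P n
  binary-induction P P0 even odd n = go n (<-wellFounded n)
    where
    go : ∀ n → Acc _<_ n → P n
    go n (acc rec) with parity n
    go n (acc rec) | zero  , inj₁ refl = P0
    go n (acc rec) | suc k , inj₁ refl = even (suc k) (go (suc k) (rec (s≤s (s≤s (m≤m*n k 2)))))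
    go n (acc rec) | k , inj₂ refl = odd k (go k (rec (s≤s (m≤m*n k 2))))

  s₂-aux-stable : ∀ f g {m} → m ≤ f → m ≤ g → s₂-aux f m ≡ s₂-aux g m
  s₂-aux-stable zero    zero    _      _      = refl
  s₂-aux-stable zero    (suc g) z≤n    _      = s₂-aux-stable zero g z≤n z≤n
  s₂-aux-stable (suc f) zero    _      z≤n    = s₂-aux-stable f zero z≤n z≤n
  s₂-aux-stable (suc f) (suc g) {m} m≤1+f m≤1+g = cong (λ r → m % 2 + r) (s₂-aux-stable f g (half≤ m≤1+f) (half≤ m≤1+g))
    where
    half≤ : ∀ {m f} → m ≤ suc f → m / 2 ≤ f
    half≤ {zero}  _   = z≤n
    half≤ {suc m} m≤f = ≤-pred (<-≤-trans (m/n<m (suc m) 2 (s≤s (s≤s z≤n))) m≤f)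

  s₂-*2 : ∀ k → s₂ (k * 2) ≡ s₂ k
  s₂-*2 zero    = refl
  s₂-*2 (suc k) = begin
    (suc k * 2) % 2 + s₂-aux (suc (k * 2)) ((suc k * 2) / 2) ≡⟨ cong₂ (λ r q → r + s₂-aux (suc (k * 2)) q) (m*n%n≡0 (suc k) 2) (m*n/n≡m (suc k) 2) ⟩
    s₂-aux (suc (k * 2)) (suc k)                             ≡⟨ s₂-aux-stable (suc (k * 2)) (suc k) (s≤s (m≤m*n k 2)) ≤-refl ⟩
    s₂ (suc k)                                               ∎
    where open ≡-Reasoning

  s₂-1+*2 : ∀ k → s₂ (suc (k * 2)) ≡ suc (s₂ k)
  s₂-1+*2 k = begin
    (1 + k * 2) % 2 + s₂-aux (k * 2) ((1 + k * 2) / 2) ≡⟨ cong₂ (λ r q → r + s₂-aux (k * 2) q) ([m+kn]%n≡m%n 1 k 2) [1+k*2]/2≡k ⟩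
    1 + s₂-aux (k * 2) k                               ≡⟨ cong suc (s₂-aux-stable (k * 2) k (m≤m*n k 2) ≤-refl) ⟩
    suc (s₂ k)                                         ∎
    where
    open ≡-Reasoning
    [1+k*2]/2≡k : (1 + k * 2) / 2 ≡ k
    [1+k*2]/2≡k = trans (+-distrib-/ 1 (k * 2) (subst (λ r → 1 + r < 2) (sym (m*n%n≡0 k 2)) ≤-refl)) (m*n/n≡m k 2)

  1≤s₂ : ∀ {n} → n ≢ 0 → 1 ≤ s₂ n
  1≤s₂ = binary-induction (λ n → n ≢ 0 → 1 ≤ s₂ n) (λ 0≢0 → contradiction refl 0≢0) even odd _
    where
    even : ∀ k → (k ≢ 0 → 1 ≤ s₂ k) → k * 2 ≢ 0 → 1 ≤ s₂ (k * 2)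
    even k ih 2k≢0 = subst (1 ≤_) (sym (s₂-*2 k)) (ih (λ k≡0 → 2k≢0 (cong (_* 2) k≡0)))
    odd : ∀ k → (k ≢ 0 → 1 ≤ s₂ k) → suc (k * 2) ≢ 0 → 1 ≤ s₂ (suc (k * 2))
    odd k _ _ = subst (1 ≤_) (sym (s₂-1+*2 k)) (s≤s z≤n)

  -- ord₂ (n + 1) = s₂ n + 1 - s₂ (n + 1)
  2^s₂n*2*odd≡2^s₂[1+n]*[1+n] : ∀ n → ∃ λ o → Odd o × 2 ^ s₂ n * 2 * o ≡ 2 ^ s₂ (suc n) * suc n
  2^s₂n*2*odd≡2^s₂[1+n]*[1+n] = binary-induction _ (1 , odd-1+k*2 0 , refl) even odd
    where
    even : ∀ k → _ → ∃ λ o → Odd o × 2 ^ s₂ (k * 2) * 2 * o ≡ 2 ^ s₂ (suc (k * 2)) * suc (k * 2)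
    even k _ = suc (k * 2) , odd-1+k*2 k , (begin
      2 ^ s₂ (k * 2) * 2 * suc (k * 2)   ≡⟨ cong (λ e → 2 ^ e * 2 * suc (k * 2)) (s₂-*2 k) ⟩
      2 ^ s₂ k * 2 * suc (k * 2)         ≡⟨ cong (_* suc (k * 2)) (*-comm (2 ^ s₂ k) 2) ⟩
      2 ^ suc (s₂ k) * suc (k * 2)       ≡⟨ cong (λ e → 2 ^ e * suc (k * 2)) (s₂-1+*2 k) ⟨
      2 ^ s₂ (suc (k * 2)) * suc (k * 2) ∎)
      where open ≡-Reasoning
    odd : ∀ k → (∃ λ o → Odd o × 2 ^ s₂ k * 2 * o ≡ 2 ^ s₂ (suc k) * suc k) →
          ∃ λ o → Odd o × 2 ^ s₂ (suc (k * 2)) * 2 * o ≡ 2 ^ s₂ (suc (suc (k * 2))) * suc (suc (k * 2))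
    odd k (o , odd-o , ih) = o , odd-o , (begin
      2 ^ s₂ (suc (k * 2)) * 2 * o     ≡⟨ cong (λ e → 2 ^ e * 2 * o) (s₂-1+*2 k) ⟩
      2 * 2 ^ s₂ k * 2 * o             ≡⟨ regroup (2 ^ s₂ k) o ⟩
      2 * (2 ^ s₂ k * 2 * o)           ≡⟨ cong (2 *_) ih ⟩
      2 * (2 ^ s₂ (suc k) * suc k)     ≡⟨ regroup′ (2 ^ s₂ (suc k)) k ⟩
      2 ^ s₂ (suc k) * (suc k * 2)     ≡⟨ cong (λ e → 2 ^ e * (suc k * 2)) (s₂-*2 (suc k)) ⟨
      2 ^ s₂ (suc k * 2) * (suc k * 2) ∎)
      where
      open ≡-Reasoning
      regroup : ∀ p o → 2 * p * 2 * o ≡ 2 * (p * 2 * o)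
      regroup = solve-∀
      regroup′ : ∀ p k → 2 * (p * suc k) ≡ p * (suc k * 2)
      regroup′ = solve-∀

-- Rationals and polynomials over them

open import Data.Rational as ℚ using (ℚ; mkℚ; 0ℚ; 1ℚ; ½; _+_; _*_; -_; _-_; toℚᵘ)
import Data.Rational.Properties as ℚP
import Data.Rational.Unnormalised as ℚᵘ
import Data.Rational.Unnormalised.Properties as ℚᵘP
open import Tactic.RingSolver using (solve-∀)
open import Algebra.Properties.Group ℚP.+-0-group using () renaming (⁻¹-involutive to -‿involutive)

ℚ-ring : AlmostCommutativeRing _ _
ℚ-ring = fromCommutativeRing ℚP.+-*-commutativeRing 0≟
  where
  0≟ : ∀ x → Maybe (0ℚ ≡ x)
  0≟ x with 0ℚ ℚ.≟ x
  ... | yes p = just p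
  ... | no _  = nothing

toℚᵘ-ℤ→ℚ : ∀ a → toℚᵘ (ℤ→ℚ a) ℚᵘ.≃ ℚᵘ.mkℚᵘ a 0
toℚᵘ-ℤ→ℚ a = ℚP.toℚᵘ-fromℚᵘ (ℚᵘ.mkℚᵘ a 0)

ℤ→ℚ-+ : ∀ a b → ℤ→ℚ (a ℤ.+ b) ≡ ℤ→ℚ a + ℤ→ℚ b
ℤ→ℚ-+ a b = ℚP.toℚᵘ-injective (begin
  toℚᵘ (ℤ→ℚ (a ℤ.+ b))           ≈⟨ toℚᵘ-ℤ→ℚ (a ℤ.+ b) ⟩
  ℚᵘ.mkℚᵘ (a ℤ.+ b) 0            ≈⟨ ℚᵘ.*≡* (cong₂ (λ u v → (u ℤ.+ v) ℤ.* + 1) (sym (ℤP.*-identityʳ a)) (sym (ℤP.*-identityʳ b))) ⟩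
  ℚᵘ.mkℚᵘ a 0 ℚᵘ.+ ℚᵘ.mkℚᵘ b 0   ≈⟨ ℚᵘP.+-cong (toℚᵘ-ℤ→ℚ a) (toℚᵘ-ℤ→ℚ b) ⟨
  toℚᵘ (ℤ→ℚ a) ℚᵘ.+ toℚᵘ (ℤ→ℚ b) ≈⟨ ℚP.toℚᵘ-homo-+ (ℤ→ℚ a) (ℤ→ℚ b) ⟨
  toℚᵘ (ℤ→ℚ a + ℤ→ℚ b)           ∎)
  where open ℚᵘP.≃-Reasoning

ℤ→ℚ-* : ∀ a b → ℤ→ℚ (a ℤ.* b) ≡ ℤ→ℚ a * ℤ→ℚ b
ℤ→ℚ-* a b = ℚP.toℚᵘ-injective (begin
  toℚᵘ (ℤ→ℚ (a ℤ.* b))           ≈⟨ toℚᵘ-ℤ→ℚ (a ℤ.* b) ⟩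
  ℚᵘ.mkℚᵘ a 0 ℚᵘ.* ℚᵘ.mkℚᵘ b 0   ≈⟨ ℚᵘP.*-cong (toℚᵘ-ℤ→ℚ a) (toℚᵘ-ℤ→ℚ b) ⟨
  toℚᵘ (ℤ→ℚ a) ℚᵘ.* toℚᵘ (ℤ→ℚ b) ≈⟨ ℚP.toℚᵘ-homo-* (ℤ→ℚ a) (ℤ→ℚ b) ⟨
  toℚᵘ (ℤ→ℚ a * ℤ→ℚ b)           ∎)
  where open ℚᵘP.≃-Reasoning

ℤ→ℚ-neg : ∀ a → ℤ→ℚ (ℤ.- a) ≡ - ℤ→ℚ a
ℤ→ℚ-neg a = ℚP.toℚᵘ-injective (begin
  toℚᵘ (ℤ→ℚ (ℤ.- a)) ≈⟨ toℚᵘ-ℤ→ℚ (ℤ.- a) ⟩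
  ℚᵘ.- ℚᵘ.mkℚᵘ a 0   ≈⟨ ℚᵘP.-‿cong (toℚᵘ-ℤ→ℚ a) ⟨
  ℚᵘ.- toℚᵘ (ℤ→ℚ a)  ≈⟨ ℚP.toℚᵘ-homo‿- (ℤ→ℚ a) ⟨
  toℚᵘ (- ℤ→ℚ a)     ∎)
  where open ℚᵘP.≃-Reasoning

ℤ→ℚ-injective : ∀ {a b} → ℤ→ℚ a ≡ ℤ→ℚ b → a ≡ b
ℤ→ℚ-injective {a} {b} eq with ℚᵘP.≃-trans (ℚᵘP.≃-sym (toℚᵘ-ℤ→ℚ a)) (ℚᵘP.≃-trans (ℚᵘP.≃-reflexive (cong toℚᵘ eq)) (toℚᵘ-ℤ→ℚ b))
... | ℚᵘ.*≡* eq′ = trans (sym (ℤP.*-identityʳ a)) (trans eq′ (ℤP.*-identityʳ b))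

ℕ→ℚ-+ : ∀ m n → ℕ→ℚ (m ℕ.+ n) ≡ ℕ→ℚ m + ℕ→ℚ n
ℕ→ℚ-+ m n = ℤ→ℚ-+ (+ m) (+ n)

ℕ→ℚ-* : ∀ m n → ℕ→ℚ (m ℕ.* n) ≡ ℕ→ℚ m * ℕ→ℚ n
ℕ→ℚ-* m n = trans (cong ℤ→ℚ (ℤP.pos-* m n)) (ℤ→ℚ-* (+ m) (+ n))

/-≡-*invℕ : ∀ n d → (+ n) ℚ./ suc d ≡ ℕ→ℚ n * invℕ (suc d)
/-≡-*invℕ n d = ℚP.toℚᵘ-injective (begin
  toℚᵘ ((+ n) ℚ./ suc d)                ≈⟨ ℚP.toℚᵘ-fromℚᵘ (ℚᵘ.mkℚᵘ (+ n) d) ⟩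
  ℚᵘ.mkℚᵘ (+ n) d                       ≈⟨ ℚᵘ.*≡* (sym (ℤP.*-assoc (+ n) (+ 1) (+ suc d))) ⟩
  ℚᵘ.mkℚᵘ (+ n) 0 ℚᵘ.* ℚᵘ.mkℚᵘ (+ 1) d  ≈⟨ ℚᵘP.*-cong (toℚᵘ-ℤ→ℚ (+ n)) (ℚP.toℚᵘ-fromℚᵘ (ℚᵘ.mkℚᵘ (+ 1) d)) ⟨
  toℚᵘ (ℕ→ℚ n) ℚᵘ.* toℚᵘ (invℕ (suc d)) ≈⟨ ℚP.toℚᵘ-homo-* (ℕ→ℚ n) (invℕ (suc d)) ⟨
  toℚᵘ (ℕ→ℚ n * invℕ (suc d))           ∎)
  where open ℚᵘP.≃-Reasoning

*↧≡↥ : ∀ q → q * ℕ→ℚ (ℚ.↧ₙ q) ≡ ℤ→ℚ (ℚ.↥ q)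
*↧≡↥ q@(mkℚ a d _) = ℚP.toℚᵘ-injective (begin
  toℚᵘ (q * ℕ→ℚ (suc d))               ≈⟨ ℚP.toℚᵘ-homo-* q (ℕ→ℚ (suc d)) ⟩
  ℚᵘ.mkℚᵘ a d ℚᵘ.* toℚᵘ (ℕ→ℚ (suc d))  ≈⟨ ℚᵘP.*-congˡ {ℚᵘ.mkℚᵘ a d} (toℚᵘ-ℤ→ℚ (+ suc d)) ⟩
  ℚᵘ.mkℚᵘ a d ℚᵘ.* ℚᵘ.mkℚᵘ (+ suc d) 0 ≈⟨ ℚᵘ.*≡* (trans (ℤP.*-identityʳ _) (cong (a ℤ.*_) (cong +_ (sym (ℕP.*-identityʳ (suc d)))))) ⟩
  ℚᵘ.mkℚᵘ a 0                          ≈⟨ toℚᵘ-ℤ→ℚ a ⟨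
  toℚᵘ (ℤ→ℚ a)                         ∎)
  where open ℚᵘP.≃-Reasoning

invℕ-inverseˡ : ∀ n .{{_ : NonZero n}} → invℕ n * ℕ→ℚ n ≡ 1ℚ
invℕ-inverseˡ (suc d) = ℚP.toℚᵘ-injective (begin
  toℚᵘ (invℕ (suc d) * ℕ→ℚ (suc d))           ≈⟨ ℚP.toℚᵘ-homo-* (invℕ (suc d)) (ℕ→ℚ (suc d)) ⟩
  toℚᵘ (invℕ (suc d)) ℚᵘ.* toℚᵘ (ℕ→ℚ (suc d)) ≈⟨ ℚᵘP.*-cong (ℚP.toℚᵘ-fromℚᵘ (ℚᵘ.mkℚᵘ (+ 1) d)) (toℚᵘ-ℤ→ℚ (+ suc d)) ⟩
  ℚᵘ.mkℚᵘ (+ 1) d ℚᵘ.* ℚᵘ.mkℚᵘ (+ suc d) 0    ≈⟨ ℚᵘ.*≡* (trans (ℤP.*-identityʳ _) (trans (ℤP.*-identityˡ _) (sym (trans (ℤP.*-identityˡ _) (cong +_ (ℕP.*-identityʳ (suc d))))))) ⟩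
  ℚᵘ.1ℚᵘ                                      ∎)
  where open ℚᵘP.≃-Reasoning

*-cancelʳ-ℕ→ℚ : ∀ n .{{_ : NonZero n}} {x y} → x * ℕ→ℚ n ≡ y * ℕ→ℚ n → x ≡ y
*-cancelʳ-ℕ→ℚ n {x} {y} eq = begin
  x                  ≡⟨ lemma x ⟨
  x * ℕ→ℚ n * invℕ n ≡⟨ cong (_* invℕ n) eq ⟩
  y * ℕ→ℚ n * invℕ n ≡⟨ lemma y ⟩
  y                  ∎
  where
  open ≡-Reasoning
  lemma : ∀ z → z * ℕ→ℚ n * invℕ n ≡ z
  lemma z = trans (ℚP.*-assoc z _ _) (trans (cong (z *_) (trans (ℚP.*-comm (ℕ→ℚ n) (invℕ n)) (invℕ-inverseˡ n))) (ℚP.*-identityʳ z))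

ℕ→ℚ-*invℕ-cross : ∀ a b c d .{{_ : NonZero b}} .{{_ : NonZero d}} → a ℕ.* d ≡ c ℕ.* b → ℕ→ℚ a * invℕ b ≡ ℕ→ℚ c * invℕ d
ℕ→ℚ-*invℕ-cross a b c d ad≡cb = *-cancelʳ-ℕ→ℚ b (*-cancelʳ-ℕ→ℚ d (begin
  ℕ→ℚ a * invℕ b * ℕ→ℚ b * ℕ→ℚ d     ≡⟨ regroup (ℕ→ℚ a) (invℕ b) (ℕ→ℚ b) (ℕ→ℚ d) ⟩
  (invℕ b * ℕ→ℚ b) * (ℕ→ℚ a * ℕ→ℚ d) ≡⟨ cong₂ _*_ (invℕ-inverseˡ b) (sym (ℕ→ℚ-* a d)) ⟩
  1ℚ * ℕ→ℚ (a ℕ.* d)                 ≡⟨ cong₂ _*_ (sym (invℕ-inverseˡ d)) (trans (cong ℕ→ℚ ad≡cb) (ℕ→ℚ-* c b)) ⟩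
  (invℕ d * ℕ→ℚ d) * (ℕ→ℚ c * ℕ→ℚ b) ≡⟨ regroup′ (ℕ→ℚ c) (invℕ d) (ℕ→ℚ b) (ℕ→ℚ d) ⟩
  ℕ→ℚ c * invℕ d * ℕ→ℚ b * ℕ→ℚ d     ∎))
  where
  open ≡-Reasoning
  regroup : ∀ a i b d → a * i * b * d ≡ (i * b) * (a * d)
  regroup = solve-∀ ℚ-ring
  regroup′ : ∀ c i b d → (i * d) * (c * b) ≡ c * i * b * d
  regroup′ = solve-∀ ℚ-ring

invℕ-* : ∀ m n .{{_ : NonZero m}} .{{_ : NonZero n}} → invℕ (m ℕ.* n) ≡ invℕ m * invℕ n
invℕ-* m n = *-cancelʳ-ℕ→ℚ (m ℕ.* n) {{ℕP.m*n≢0 m n}} (begin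
  invℕ (m ℕ.* n) * ℕ→ℚ (m ℕ.* n)      ≡⟨ invℕ-inverseˡ (m ℕ.* n) {{ℕP.m*n≢0 m n}} ⟩
  1ℚ                                  ≡⟨ cong₂ _*_ (invℕ-inverseˡ m) (invℕ-inverseˡ n) ⟨
  (invℕ m * ℕ→ℚ m) * (invℕ n * ℕ→ℚ n) ≡⟨ regroup (invℕ m) (ℕ→ℚ m) (invℕ n) (ℕ→ℚ n) ⟩
  invℕ m * invℕ n * (ℕ→ℚ m * ℕ→ℚ n)   ≡⟨ cong (invℕ m * invℕ n *_) (ℕ→ℚ-* m n) ⟨
  invℕ m * invℕ n * ℕ→ℚ (m ℕ.* n)     ∎)
  where
  open ≡-Reasoning
  regroup : ∀ a b c d → (a * b) * (c * d) ≡ a * c * (b * d)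
  regroup = solve-∀ ℚ-ring

coeff-+ₚ : ∀ p q j → coeff (p +ₚ q) j ≡ coeff p j + coeff q j
coeff-+ₚ []      q       j       = sym (ℚP.+-identityˡ _)
coeff-+ₚ (a ∷ p) []      j       = sym (ℚP.+-identityʳ _)
coeff-+ₚ (a ∷ p) (b ∷ q) zero    = refl
coeff-+ₚ (a ∷ p) (b ∷ q) (suc j) = coeff-+ₚ p q j

coeff-·ₚ : ∀ c p j → coeff (c ·ₚ p) j ≡ c * coeff p j
coeff-·ₚ c []      j       = sym (ℚP.*-zeroʳ c)
coeff-·ₚ c (a ∷ p) zero    = refl
coeff-·ₚ c (a ∷ p) (suc j) = coeff-·ₚ c p j

-1*≡- : ∀ x → (- 1ℚ) * x ≡ - x
-1*≡- = solve-∀ ℚ-ring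

coeff--ₚ : ∀ p q j → coeff (p -ₚ q) j ≡ coeff p j - coeff q j
coeff--ₚ p q j = trans (coeff-+ₚ p ((- 1ℚ) ·ₚ q) j) (cong (λ u → coeff p j + u) (trans (coeff-·ₚ (- 1ℚ) q j) (-1*≡- (coeff q j))))

coeff-mon : ∀ c i → coeff (mon c i) i ≡ c
coeff-mon c zero    = refl
coeff-mon c (suc i) = coeff-mon c i

coeff-mon-≢ : ∀ c {i j} → i ≢ j → coeff (mon c i) j ≡ 0ℚ
coeff-mon-≢ c {zero}  {zero}  i≢j = contradiction refl i≢j
coeff-mon-≢ c {zero}  {suc j} i≢j = refl
coeff-mon-≢ c {suc i} {zero}  i≢j = refl
coeff-mon-≢ c {suc i} {suc j} i≢j = coeff-mon-≢ c (i≢j ∘ cong suc)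

module _ (a : ℕ → ℚ) (e : ℕ → ℕ) {j : ℕ} where

  coeff-sumP-mon-absent : ∀ m → (∀ k → k < m → e k ≢ j) → coeff (sumP (λ k → mon (a k) (e k)) m) j ≡ 0ℚ
  coeff-sumP-mon-absent zero    _      = refl
  coeff-sumP-mon-absent (suc m) absent = begin
    coeff (sumP _ m +ₚ mon (a m) (e m)) j       ≡⟨ coeff-+ₚ (sumP _ m) _ j ⟩
    coeff (sumP _ m) j + coeff (mon (a m) (e m)) j
      ≡⟨ cong₂ _+_ (coeff-sumP-mon-absent m (λ k k<m → absent k (ℕP.m<n⇒m<1+n k<m))) (coeff-mon-≢ (a m) (absent m ℕP.≤-refl)) ⟩
    0ℚ + 0ℚ ≡⟨⟩
    0ℚ      ∎
    where open ≡-Reasoning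

  coeff-sumP-mon-unique : ∀ m {k₀} → k₀ < m → e k₀ ≡ j → (∀ k → k < m → e k ≡ j → k ≡ k₀) →
                          coeff (sumP (λ k → mon (a k) (e k)) m) j ≡ a k₀
  coeff-sumP-mon-unique (suc m) {k₀} k₀<1+m ek₀≡j unique with k₀ ℕ.≟ m
  ... | yes refl = begin
    coeff (sumP _ m +ₚ mon (a m) (e m)) j          ≡⟨ coeff-+ₚ (sumP _ m) _ j ⟩
    coeff (sumP _ m) j + coeff (mon (a m) (e m)) j ≡⟨ cong₂ _+_ (coeff-sumP-mon-absent m earlier-absent) (subst (λ i → coeff (mon (a m) (e m)) i ≡ a m) ek₀≡j (coeff-mon (a m) (e m))) ⟩
    0ℚ + a m                                       ≡⟨ ℚP.+-identityˡ (a m) ⟩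
    a m                                            ∎
    where
    open ≡-Reasoning
    earlier-absent : ∀ k → k < m → e k ≢ j
    earlier-absent k k<m ek≡j = ℕP.<-irrefl (unique k (ℕP.m<n⇒m<1+n k<m) ek≡j) k<m
  ... | no k₀≢m = begin
    coeff (sumP _ m +ₚ mon (a m) (e m)) j          ≡⟨ coeff-+ₚ (sumP _ m) _ j ⟩
    coeff (sumP _ m) j + coeff (mon (a m) (e m)) j
      ≡⟨ cong₂ _+_ (coeff-sumP-mon-unique m (ℕP.≤∧≢⇒< (ℕP.≤-pred k₀<1+m) k₀≢m) ek₀≡j (λ k k<m → unique k (ℕP.m<n⇒m<1+n k<m)))
                   (coeff-mon-≢ (a m) (λ em≡j → k₀≢m (sym (unique m ℕP.≤-refl em≡j)))) ⟩
    a k₀ + 0ℚ ≡⟨ ℚP.+-identityʳ (a k₀) ⟩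
    a k₀      ∎
    where open ≡-Reasoning

-- prev (coeff p) is the coefficient sequence of x · p
prev : (ℕ → ℚ) → ℕ → ℚ
prev f zero    = 0ℚ
prev f (suc j) = f j

coeff-[X-1]*ₚ : ∀ q j → coeff ((X -ₚ constP 1ℚ) *ₚ q) j ≡ prev (coeff q) j - coeff q j
coeff-[X-1]*ₚ q j = begin
  coeff ((0ℚ - 1ℚ) ·ₚ q +ₚ (0ℚ ∷ (1ℚ ·ₚ q +ₚ (0ℚ ∷ [])))) j
    ≡⟨ coeff-+ₚ ((0ℚ - 1ℚ) ·ₚ q) _ j ⟩
  coeff ((0ℚ - 1ℚ) ·ₚ q) j + coeff (0ℚ ∷ (1ℚ ·ₚ q +ₚ (0ℚ ∷ []))) j
    ≡⟨ cong₂ _+_ (coeff-·ₚ (0ℚ - 1ℚ) q j) (shifted j) ⟩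
  (0ℚ - 1ℚ) * coeff q j + prev (coeff q) j
    ≡⟨ -1*x+y≡y-x (coeff q j) (prev (coeff q) j) ⟩
  prev (coeff q) j - coeff q j ∎
  where
  open ≡-Reasoning
  -1*x+y≡y-x : ∀ x y → (0ℚ - 1ℚ) * x + y ≡ y - x
  -1*x+y≡y-x = solve-∀ ℚ-ring
  coeff-0 : ∀ i → coeff (0ℚ ∷ []) i ≡ 0ℚ
  coeff-0 zero    = refl
  coeff-0 (suc i) = refl
  shifted : ∀ i → coeff (0ℚ ∷ (1ℚ ·ₚ q +ₚ (0ℚ ∷ []))) i ≡ prev (coeff q) i
  shifted zero    = refl
  shifted (suc i) = trans (coeff-+ₚ (1ℚ ·ₚ q) _ i) (trans (cong₂ _+_ (coeff-·ₚ 1ℚ q i) (coeff-0 i)) (trans (ℚP.+-identityʳ _) (ℚP.*-identityˡ _)))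

infixr 8 _^_
_^_ : ℚ → ℕ → ℚ
x ^ zero  = 1ℚ
x ^ suc m = x * x ^ m

eval-+ₚ : ∀ p q x → eval (p +ₚ q) x ≡ eval p x + eval q x
eval-+ₚ []      q       x = sym (ℚP.+-identityˡ _)
eval-+ₚ (a ∷ p) []      x = sym (ℚP.+-identityʳ _)
eval-+ₚ (a ∷ p) (b ∷ q) x = trans (cong (λ v → (a + b) + x * v) (eval-+ₚ p q x)) (lemma a b x (eval p x) (eval q x))
  where
  lemma : ∀ a b x u v → (a + b) + x * (u + v) ≡ (a + x * u) + (b + x * v)
  lemma = solve-∀ ℚ-ring

eval-·ₚ : ∀ c p x → eval (c ·ₚ p) x ≡ c * eval p x
eval-·ₚ c []      x = sym (ℚP.*-zeroʳ c)
eval-·ₚ c (a ∷ p) x = trans (cong (λ v → c * a + x * v) (eval-·ₚ c p x)) (lemma c a x (eval p x))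
  where
  lemma : ∀ c a x u → c * a + x * (c * u) ≡ c * (a + x * u)
  lemma = solve-∀ ℚ-ring

eval-*ₚ : ∀ p q x → eval (p *ₚ q) x ≡ eval p x * eval q x
eval-*ₚ []      q x = sym (ℚP.*-zeroˡ (eval q x))
eval-*ₚ (a ∷ p) q x = begin
  eval (a ·ₚ q +ₚ mulX (p *ₚ q)) x                ≡⟨ eval-+ₚ (a ·ₚ q) (mulX (p *ₚ q)) x ⟩
  eval (a ·ₚ q) x + (0ℚ + x * eval (p *ₚ q) x)    ≡⟨ cong₂ (λ u v → u + (0ℚ + x * v)) (eval-·ₚ a q x) (eval-*ₚ p q x) ⟩
  a * eval q x + (0ℚ + x * (eval p x * eval q x)) ≡⟨ lemma a x (eval p x) (eval q x) ⟩
  (a + x * eval p x) * eval q x                   ∎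
  where
  open ≡-Reasoning
  lemma : ∀ a x u v → a * v + (0ℚ + x * (u * v)) ≡ (a + x * u) * v
  lemma = solve-∀ ℚ-ring

eval-mon : ∀ c m x → eval (mon c m) x ≡ c * x ^ m
eval-mon c zero    x = lemma c x
  where
  lemma : ∀ c x → c + x * 0ℚ ≡ c * 1ℚ
  lemma = solve-∀ ℚ-ring
eval-mon c (suc m) x = trans (cong (λ v → 0ℚ + x * v) (eval-mon c m x)) (lemma c x (x ^ m))
  where
  lemma : ∀ c x u → 0ℚ + x * (c * u) ≡ c * (x * u)
  lemma = solve-∀ ℚ-ring

eval-≈ₚ-[] : ∀ p → p ≈ₚ [] → ∀ x → eval p x ≡ 0ℚ
eval-≈ₚ-[] []      p≈0 x = refl
eval-≈ₚ-[] (a ∷ p) p≈0 x = trans (cong₂ (λ u v → u + x * v) (p≈0 0) (eval-≈ₚ-[] p (λ j → p≈0 (suc j)) x)) (lemma x)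
  where
  lemma : ∀ x → 0ℚ + x * 0ℚ ≡ 0ℚ
  lemma = solve-∀ ℚ-ring

eval-≈ₚ : ∀ p q → p ≈ₚ q → ∀ x → eval p x ≡ eval q x
eval-≈ₚ []      q       p≈q x = sym (eval-≈ₚ-[] q (λ j → sym (p≈q j)) x)
eval-≈ₚ (a ∷ p) []      p≈q x = eval-≈ₚ-[] (a ∷ p) p≈q x
eval-≈ₚ (a ∷ p) (b ∷ q) p≈q x = cong₂ (λ u v → u + x * v) (p≈q 0) (eval-≈ₚ p q (λ j → p≈q (suc j)) x)

eval--ₚ : ∀ p q x → eval (p -ₚ q) x ≡ eval p x - eval q x
eval--ₚ p q x = trans (eval-+ₚ p ((- 1ℚ) ·ₚ q) x) (cong (λ u → eval p x + u) (trans (eval-·ₚ (- 1ℚ) q x) (-1*≡- (eval q x))))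

eval-X-1 : ∀ x → eval (X -ₚ constP 1ℚ) x ≡ x - 1ℚ
eval-X-1 = lemma
  where
  lemma : ∀ x → (0ℚ + - 1ℚ * 1ℚ) + x * (1ℚ + x * 0ℚ) ≡ x - 1ℚ
  lemma = solve-∀ ℚ-ring

-- The closed form and the recurrence

coeff-𝒮 : ∀ r n {j} → j ≤ n → coeff (𝒮 r n) j ≡ ℕ→ℚ (n C (n ∸ j)) * sgn (n ∸ j) * invℕ ((r ℕ.+ (n ∸ j)) C r)
coeff-𝒮 r n {j} j≤n = coeff-sumP-mon-unique _ (n ∸_) (suc n) (s≤s (ℕP.m∸n≤m n j)) (ℕP.m∸[m∸n]≡n j≤n) unique
  where
  unique : ∀ k → k < suc n → n ∸ k ≡ j → k ≡ n ∸ j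
  unique k k<1+n refl = sym (ℕP.m∸[m∸n]≡n (ℕP.≤-pred k<1+n))

coeff-𝒮-high : ∀ r n {j} → n < j → coeff (𝒮 r n) j ≡ 0ℚ
coeff-𝒮-high r n n<j = coeff-sumP-mon-absent _ (n ∸_) (suc n) (λ k _ n∸k≡j → ℕP.<-irrefl n∸k≡j (ℕP.≤-<-trans (ℕP.m∸n≤m n k) n<j))

coeff-𝒮-diagonal : ∀ n {j} → j ≤ n → coeff (𝒮 n n) j ≡ invℕ (central n) * (ℕ→ℚ ((2 ℕ.* n) C j) * sgn (n ∸ j))
coeff-𝒮-diagonal n {j} j≤n = begin
  coeff (𝒮 n n) j                                  ≡⟨ coeff-𝒮 n n j≤n ⟩
  ℕ→ℚ (n C k) * sgn k * invℕ ((n ℕ.+ k) C n)       ≡⟨ regroup (ℕ→ℚ (n C k)) (sgn k) (invℕ ((n ℕ.+ k) C n)) ⟩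
  ℕ→ℚ (n C k) * invℕ ((n ℕ.+ k) C n) * sgn k       ≡⟨ cong (_* sgn k) ratio ⟩
  ℕ→ℚ ((2 ℕ.* n) C j) * invℕ (central n) * sgn k   ≡⟨ regroup′ (ℕ→ℚ ((2 ℕ.* n) C j)) (invℕ (central n)) (sgn k) ⟩
  invℕ (central n) * (ℕ→ℚ ((2 ℕ.* n) C j) * sgn k) ∎
  where
  open ≡-Reasoning
  k = n ∸ j
  regroup : ∀ a s i → a * s * i ≡ a * i * s
  regroup = solve-∀ ℚ-ring
  regroup′ : ∀ c i s → c * i * s ≡ i * (c * s)
  regroup′ = solve-∀ ℚ-ring
  ratio : ℕ→ℚ (n C k) * invℕ ((n ℕ.+ k) C n) ≡ ℕ→ℚ ((2 ℕ.* n) C j) * invℕ (central n)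
  ratio = ℕ→ℚ-*invℕ-cross (n C k) ((n ℕ.+ k) C n) ((2 ℕ.* n) C j) (central n) {{nCk≢0 (ℕP.m≤m+n n k)}} {{central≢0 n}} (central-ratio j≤n)

𝒮-diagonal-closed-form : ∀ n → 𝒮 n n ≈ₚ invℕ (central n) ·ₚ sumP (λ k → mon (ℕ→ℚ ((2 ℕ.* n) C k) * sgn (n ∸ k)) k) (suc n)
𝒮-diagonal-closed-form n j = by-degree (j ℕ.≤? n)
  where
  open ≡-Reasoning
  a : ℕ → ℚ
  a k = ℕ→ℚ ((2 ℕ.* n) C k) * sgn (n ∸ k)
  Σa = sumP (λ k → mon (a k) k) (suc n)
  by-degree : Dec (j ≤ n) → coeff (𝒮 n n) j ≡ coeff (invℕ (central n) ·ₚ Σa) j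
  by-degree (yes j≤n) = begin
    coeff (𝒮 n n) j                  ≡⟨ coeff-𝒮-diagonal n j≤n ⟩
    invℕ (central n) * a j           ≡⟨ cong (invℕ (central n) *_) (coeff-sumP-mon-unique a (λ k → k) (suc n) (s≤s j≤n) refl (λ _ _ k≡j → k≡j)) ⟨
    invℕ (central n) * coeff Σa j    ≡⟨ coeff-·ₚ (invℕ (central n)) Σa j ⟨
    coeff (invℕ (central n) ·ₚ Σa) j ∎
  by-degree (no j≰n) = begin
    coeff (𝒮 n n) j                  ≡⟨ coeff-𝒮-high n n (ℕP.≰⇒> j≰n) ⟩
    0ℚ                               ≡⟨ ℚP.*-zeroʳ (invℕ (central n)) ⟨
    invℕ (central n) * 0ℚ            ≡⟨ cong (invℕ (central n) *_) (coeff-sumP-mon-absent a (λ k → k) (suc n) (λ k k<1+n k≡j → j≰n (subst (_≤ n) k≡j (ℕP.≤-pred k<1+n)))) ⟨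
    invℕ (central n) * coeff Σa j    ≡⟨ coeff-·ₚ (invℕ (central n)) Σa j ⟨
    coeff (invℕ (central n) ·ₚ Σa) j ∎

coeff-𝒮-top : ∀ n → coeff (𝒮 n n) n ≡ 1ℚ
coeff-𝒮-top n = begin
  coeff (𝒮 n n) n                                    ≡⟨ coeff-𝒮-diagonal n ℕP.≤-refl ⟩
  invℕ (central n) * (ℕ→ℚ (central n) * sgn (n ∸ n)) ≡⟨ cong (λ k → invℕ (central n) * (ℕ→ℚ (central n) * sgn k)) (ℕP.n∸n≡0 n) ⟩
  invℕ (central n) * (ℕ→ℚ (central n) * 1ℚ)          ≡⟨ cong (invℕ (central n) *_) (ℚP.*-identityʳ _) ⟩
  invℕ (central n) * ℕ→ℚ (central n)                 ≡⟨ invℕ-inverseˡ (central n) {{central≢0 n}} ⟩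
  1ℚ                                                 ∎
  where open ≡-Reasoning

ρ : ℕ → ℚ
ρ n = (ℤ.+ suc n) ℚ./ suc (2 ℕ.* n)

ρ*invℕ-central : ∀ n → ρ n * invℕ (central n) ≡ ℕ→ℚ (suc n) * invℕ (suc (2 ℕ.* n) ℕ.* central n)
ρ*invℕ-central n = begin
  ρ n * invℕ (central n)                                  ≡⟨ cong (_* invℕ (central n)) (/-≡-*invℕ (suc n) (2 ℕ.* n)) ⟩
  ℕ→ℚ (suc n) * invℕ (suc (2 ℕ.* n)) * invℕ (central n)   ≡⟨ ℚP.*-assoc (ℕ→ℚ (suc n)) _ _ ⟩
  ℕ→ℚ (suc n) * (invℕ (suc (2 ℕ.* n)) * invℕ (central n)) ≡⟨ cong (ℕ→ℚ (suc n) *_) (invℕ-* (suc (2 ℕ.* n)) (central n) {{_}} {{central≢0 n}}) ⟨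
  ℕ→ℚ (suc n) * invℕ (suc (2 ℕ.* n) ℕ.* central n)        ∎
  where open ≡-Reasoning

2*invℕ-central[1+n]≡ρ*invℕ-central : ∀ n → ℕ→ℚ 2 * invℕ (central (suc n)) ≡ ρ n * invℕ (central n)
2*invℕ-central[1+n]≡ρ*invℕ-central n = trans
  (ℕ→ℚ-*invℕ-cross 2 (central (suc n)) (suc n) (suc (2 ℕ.* n) ℕ.* central n) {{central≢0 (suc n)}} {{ℕP.m*n≢0 (suc (2 ℕ.* n)) (central n) {{_}} {{central≢0 n}}}}
    (trans (sym (ℕP.*-assoc 2 (suc (2 ℕ.* n)) (central n))) (sym ([1+n]*central[1+n]≡2[1+2n]*central n))))
  (sym (ρ*invℕ-central n))

row : ℕ → ℕ → ℚ
row N i = ℕ→ℚ (N C i)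

prev-row+row≡row : ∀ N j → prev (row N) j + row N j ≡ row (suc N) j
prev-row+row≡row N zero    = refl
prev-row+row≡row N (suc i) = trans (sym (ℕ→ℚ-+ (N C i) (N C suc i))) (cong ℕ→ℚ (nCk+nC[k+1]≡[n+1]C[k+1] N i))

prev²-row+2prev-row+row≡row : ∀ N j → prev (prev (row N)) j + ℕ→ℚ 2 * prev (row N) j + row N j ≡ row (suc (suc N)) j
prev²-row+2prev-row+row≡row N j = begin
  prev (prev (row N)) j + ℕ→ℚ 2 * prev (row N) j + row N j              ≡⟨ regroup (prev (prev (row N)) j) (prev (row N) j) (row N j) ⟩
  (prev (prev (row N)) j + prev (row N) j) + (prev (row N) j + row N j) ≡⟨ cong₂ _+_ (prev-prev-row j) (prev-row+row≡row N j) ⟩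
  prev (row (suc N)) j + row (suc N) j                                  ≡⟨ prev-row+row≡row (suc N) j ⟩
  row (suc (suc N)) j                                                   ∎
  where
  open ≡-Reasoning
  regroup : ∀ a b c → a + ℕ→ℚ 2 * b + c ≡ (a + b) + (b + c)
  regroup = solve-∀ ℚ-ring
  prev-prev-row : ∀ j → prev (prev (row N)) j + prev (row N) j ≡ prev (row (suc N)) j
  prev-prev-row zero    = refl
  prev-prev-row (suc i) = prev-row+row≡row N i

ρ*[1+invℕ-central*prev-row]≡1 : ∀ n → ρ n * (1ℚ + invℕ (central n) * prev (row (2 ℕ.* n)) n) ≡ 1ℚ
ρ*[1+invℕ-central*prev-row]≡1 n = begin
  ρ n * (1ℚ + b * prev (row (2 ℕ.* n)) n)                  ≡⟨ cong (λ u → ρ n * (u + b * prev (row (2 ℕ.* n)) n)) (invℕ-inverseˡ (central n) {{central≢0 n}}) ⟨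
  ρ n * (b * row (2 ℕ.* n) n + b * prev (row (2 ℕ.* n)) n) ≡⟨ regroup (ρ n) b (row (2 ℕ.* n) n) (prev (row (2 ℕ.* n)) n) ⟩
  ρ n * b * (prev (row (2 ℕ.* n)) n + row (2 ℕ.* n) n)     ≡⟨ cong₂ _*_ (ρ*invℕ-central n) (prev-row+row≡row (2 ℕ.* n) n) ⟩
  ℕ→ℚ (suc n) * invℕ S * ℕ→ℚ c                             ≡⟨ regroup′ (ℕ→ℚ (suc n)) (invℕ S) (ℕ→ℚ c) ⟩
  ℕ→ℚ (suc n) * ℕ→ℚ c * invℕ S                             ≡⟨ cong (_* invℕ S) (trans (sym (ℕ→ℚ-* (suc n) c)) (cong ℕ→ℚ ([1+n]*[1+2n]Cn≡[1+2n]*central n))) ⟩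
  ℕ→ℚ S * invℕ S                                           ≡⟨ ℚP.*-comm (ℕ→ℚ S) (invℕ S) ⟩
  invℕ S * ℕ→ℚ S                                           ≡⟨ invℕ-inverseˡ S {{ℕP.m*n≢0 (suc (2 ℕ.* n)) (central n) {{_}} {{central≢0 n}}}} ⟩
  1ℚ                                                       ∎
  where
  open ≡-Reasoning
  b = invℕ (central n)
  S = suc (2 ℕ.* n) ℕ.* central n
  c = suc (2 ℕ.* n) C n
  regroup : ∀ r b x y → r * (b * x + b * y) ≡ r * b * (y + x)
  regroup = solve-∀ ℚ-ring
  regroup′ : ∀ a i c → a * i * c ≡ a * c * i
  regroup′ = solve-∀ ℚ-ring

sgn-suc : ∀ k → sgn (suc k) ≡ - sgn k
sgn-suc zero          = refl
sgn-suc (suc zero)    = refl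
sgn-suc (suc (suc k)) = sgn-suc k

sgn[n∸i]≡-sgn[n∸1+i] : ∀ {n i} → i < n → sgn (n ∸ i) ≡ - sgn (n ∸ suc i)
sgn[n∸i]≡-sgn[n∸1+i] {n} {i} i<n = trans (cong sgn (ℕP.+-∸-assoc 1 i<n)) (sgn-suc (n ∸ suc i))

module _ {n : ℕ} (f g : ℕ → ℚ) (b : ℚ) (f≡ : ∀ {i} → i ≤ n → f i ≡ b * (g i * sgn (n ∸ i))) where

  private
    b*[0*s]≡0 : ∀ s → b * (0ℚ * s) ≡ 0ℚ
    b*[0*s]≡0 s = trans (cong (b *_) (ℚP.*-zeroˡ s)) (ℚP.*-zeroʳ b)

  prev-alternating : ∀ {j} → j ≤ n → prev f j ≡ b * (prev g j * - sgn (n ∸ j))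
  prev-alternating {zero}  _     = sym (b*[0*s]≡0 (- sgn n))
  prev-alternating {suc i} 1+i≤n = trans (f≡ (ℕP.<⇒≤ 1+i≤n)) (cong (λ s → b * (g i * s)) (sgn[n∸i]≡-sgn[n∸1+i] 1+i≤n))

  prev²-alternating : ∀ {j} → j ≤ n → prev (prev f) j ≡ b * (prev (prev g) j * sgn (n ∸ j))
  prev²-alternating {zero}        _     = sym (b*[0*s]≡0 (sgn n))
  prev²-alternating {suc zero}    _     = sym (b*[0*s]≡0 (sgn (n ∸ 1)))
  prev²-alternating {suc (suc i)} 2+i≤n = begin
    f i                                   ≡⟨ f≡ (ℕP.<⇒≤ (ℕP.<⇒≤ 2+i≤n)) ⟩
    b * (g i * sgn (n ∸ i))               ≡⟨ cong (λ s → b * (g i * s)) (sgn[n∸i]≡-sgn[n∸1+i] (ℕP.<⇒≤ 2+i≤n)) ⟩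
    b * (g i * - sgn (n ∸ suc i))         ≡⟨ cong (λ s → b * (g i * - s)) (sgn[n∸i]≡-sgn[n∸1+i] 2+i≤n) ⟩
    b * (g i * - - sgn (n ∸ suc (suc i))) ≡⟨ cong (λ s → b * (g i * s)) (-‿involutive (sgn (n ∸ suc (suc i)))) ⟩
    b * (g i * sgn (n ∸ suc (suc i)))     ∎
    where open ≡-Reasoning

-- Coefficient j of 2·S_{n+1,n+1} against ρ n·(x - 1)·W + x^{n+1}: for j ≤ n both are multiples of
-- binom(2n+2, j) by the double Pascal rule, at j = n + 1 both are 2, and above that both vanish.
module Recurrence (n : ℕ) where

  W : Poly
  W = Xpow (suc n) -ₚ (X -ₚ constP 1ℚ) *ₚ 𝒮 n n

  s s′ w xⁿ⁺¹ : ℕ → ℚ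
  s    = coeff (𝒮 n n)
  s′   = coeff (𝒮 (suc n) (suc n))
  w    = coeff W
  xⁿ⁺¹ = coeff (Xpow (suc n))

  b : ℚ
  b = invℕ (central n)

  w≡ : ∀ i → w i ≡ xⁿ⁺¹ i - (prev s i - s i)
  w≡ i = trans (coeff--ₚ (Xpow (suc n)) ((X -ₚ constP 1ℚ) *ₚ 𝒮 n n) i) (cong (λ u → xⁿ⁺¹ i - u) (coeff-[X-1]*ₚ (𝒮 n n) i))

  xⁿ⁺¹-low : ∀ {i} → i ≤ n → xⁿ⁺¹ i ≡ 0ℚ
  xⁿ⁺¹-low {i} i≤n = coeff-mon-≢ 1ℚ {suc n} {i} (λ 1+n≡i → ℕP.<-irrefl (sym 1+n≡i) (s≤s i≤n))

  w-low : ∀ {i} → i ≤ n → w i ≡ s i - prev s i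
  w-low {i} i≤n = trans (w≡ i) (trans (cong (_- (prev s i - s i)) (xⁿ⁺¹-low i≤n)) (lemma (prev s i) (s i)))
    where
    lemma : ∀ p x → 0ℚ - (p - x) ≡ x - p
    lemma = solve-∀ ℚ-ring

  prev-w-low : ∀ {j} → j ≤ n → prev w j ≡ prev s j - prev (prev s) j
  prev-w-low {zero}  _     = refl
  prev-w-low {suc i} 1+i≤n = w-low (ℕP.<⇒≤ 1+i≤n)

  -- x^{n+1} - (x - 1) S_{n,n} has degree ≤ n, since S_{n,n} is monic of degree n
  w-high : ∀ {i} → n < i → w i ≡ 0ℚ
  w-high {suc i} (s≤s n≤i) = next-or-above (ℕP.m≤n⇒m<n∨m≡n n≤i)
    where
    next-or-above : n < i ⊎ n ≡ i → w (suc i) ≡ 0ℚ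
    next-or-above (inj₂ refl) = begin
      w (suc n)                        ≡⟨ w≡ (suc n) ⟩
      xⁿ⁺¹ (suc n) - (s n - s (suc n)) ≡⟨ cong₂ (λ u v → u - (v - s (suc n))) (coeff-mon 1ℚ (suc n)) (coeff-𝒮-top n) ⟩
      1ℚ - (1ℚ - s (suc n))            ≡⟨ cong (λ u → 1ℚ - (1ℚ - u)) (coeff-𝒮-high n n (ℕP.n<1+n n)) ⟩
      1ℚ - (1ℚ - 0ℚ)                   ≡⟨⟩
      0ℚ                               ∎
      where open ≡-Reasoning
    next-or-above (inj₁ n<i) = begin
      w (suc i)                        ≡⟨ w≡ (suc i) ⟩
      xⁿ⁺¹ (suc i) - (s i - s (suc i)) ≡⟨ cong (_- (s i - s (suc i))) (coeff-mon-≢ 1ℚ {suc n} {suc i} (λ 1+n≡1+i → ℕP.<-irrefl (ℕP.suc-injective 1+n≡1+i) n<i)) ⟩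
      0ℚ - (s i - s (suc i))           ≡⟨ cong₂ (λ u v → 0ℚ - (u - v)) (coeff-𝒮-high n n n<i) (coeff-𝒮-high n n (ℕP.m<n⇒m<1+n n<i)) ⟩
      0ℚ - (0ℚ - 0ℚ)                   ≡⟨⟩
      0ℚ                               ∎
      where open ≡-Reasoning

  b′ : ℚ
  b′ = invℕ (central (suc n))

  s-alternating : ∀ {i} → i ≤ n → s i ≡ b * (row (2 ℕ.* n) i * sgn (n ∸ i))
  s-alternating = coeff-𝒮-diagonal n

  rhs≡ : ∀ j → coeff (ρ n ·ₚ ((X -ₚ constP 1ℚ) *ₚ W) +ₚ Xpow (suc n)) j ≡ ρ n * (prev w j - w j) + xⁿ⁺¹ j
  rhs≡ j = trans (coeff-+ₚ (ρ n ·ₚ ((X -ₚ constP 1ℚ) *ₚ W)) (Xpow (suc n)) j)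
                 (cong (_+ xⁿ⁺¹ j) (trans (coeff-·ₚ (ρ n) ((X -ₚ constP 1ℚ) *ₚ W) j) (cong (ρ n *_) (coeff-[X-1]*ₚ W j))))

  recurrence-low : ∀ {j} → j ≤ n → ℕ→ℚ 2 * s′ j ≡ ρ n * (prev w j - w j) + xⁿ⁺¹ j
  recurrence-low {j} j≤n = begin
    ℕ→ℚ 2 * s′ j                                           ≡⟨ cong (ℕ→ℚ 2 *_) (coeff-𝒮-diagonal (suc n) (ℕP.m≤n⇒m≤1+n j≤n)) ⟩
    ℕ→ℚ 2 * (b′ * (row (2 ℕ.* suc n) j * sgn (suc n ∸ j))) ≡⟨ cong₂ (λ r σ → ℕ→ℚ 2 * (b′ * (r * σ))) row-2n+2 (sgn[n∸i]≡-sgn[n∸1+i] (s≤s j≤n)) ⟩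
    ℕ→ℚ 2 * (b′ * ((p₂ + ℕ→ℚ 2 * p₁ + r) * - σ))           ≡⟨ ℚP.*-assoc (ℕ→ℚ 2) b′ _ ⟨
    ℕ→ℚ 2 * b′ * ((p₂ + ℕ→ℚ 2 * p₁ + r) * - σ)             ≡⟨ cong (_* ((p₂ + ℕ→ℚ 2 * p₁ + r) * - σ)) (2*invℕ-central[1+n]≡ρ*invℕ-central n) ⟩
    ρ n * b * ((p₂ + ℕ→ℚ 2 * p₁ + r) * - σ)                ≡⟨ lemma (ρ n) b σ r p₁ p₂ ⟩
    ρ n * ((b * (p₁ * - σ) - b * (p₂ * σ)) - (b * (r * σ) - b * (p₁ * - σ))) + 0ℚ
      ≡⟨ cong₂ (λ u v → ρ n * (u - v) + 0ℚ)
               (cong₂ _-_ (prev-alternating s (row (2 ℕ.* n)) b s-alternating j≤n) (prev²-alternating s (row (2 ℕ.* n)) b s-alternating j≤n))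
               (cong₂ _-_ (s-alternating j≤n) (prev-alternating s (row (2 ℕ.* n)) b s-alternating j≤n)) ⟨
    ρ n * ((prev s j - prev (prev s) j) - (s j - prev s j)) + 0ℚ ≡⟨ cong₂ (λ u v → ρ n * (u - v) + 0ℚ) (prev-w-low j≤n) (w-low j≤n) ⟨
    ρ n * (prev w j - w j) + 0ℚ                                  ≡⟨ cong (λ v → ρ n * (prev w j - w j) + v) (xⁿ⁺¹-low j≤n) ⟨
    ρ n * (prev w j - w j) + xⁿ⁺¹ j                              ∎
    where
    open ≡-Reasoning
    σ = sgn (n ∸ j)
    r = row (2 ℕ.* n) j
    p₁ = prev (row (2 ℕ.* n)) j
    p₂ = prev (prev (row (2 ℕ.* n))) j
    row-2n+2 : row (2 ℕ.* suc n) j ≡ p₂ + ℕ→ℚ 2 * p₁ + r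
    row-2n+2 = trans (cong (λ N → row N j) (2[1+n]≡2+2n n)) (sym (prev²-row+2prev-row+row≡row (2 ℕ.* n) j))
    lemma : ∀ c b σ r p₁ p₂ → c * b * ((p₂ + ℕ→ℚ 2 * p₁ + r) * - σ)
                             ≡ c * ((b * (p₁ * - σ) - b * (p₂ * σ)) - (b * (r * σ) - b * (p₁ * - σ))) + 0ℚ
    lemma = solve-∀ ℚ-ring

  recurrence-next : ℕ→ℚ 2 * s′ (suc n) ≡ ρ n * (prev w (suc n) - w (suc n)) + xⁿ⁺¹ (suc n)
  recurrence-next = begin
    ℕ→ℚ 2 * s′ (suc n)                                 ≡⟨ cong (ℕ→ℚ 2 *_) (coeff-𝒮-top (suc n)) ⟩
    ℕ→ℚ 2 * 1ℚ                                         ≡⟨⟩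
    1ℚ + 1ℚ                                            ≡⟨ cong (_+ 1ℚ) (ρ*[1+invℕ-central*prev-row]≡1 n) ⟨
    ρ n * (1ℚ + b * p₁) + 1ℚ                           ≡⟨ cong (λ u → ρ n * u + 1ℚ) (lemma b p₁) ⟩
    ρ n * ((1ℚ - b * (p₁ * - 1ℚ)) - 0ℚ) + 1ℚ           ≡⟨ cong₂ (λ u v → ρ n * ((u - b * (p₁ * - sgn v)) - 0ℚ) + 1ℚ) (coeff-𝒮-top n) (ℕP.n∸n≡0 n) ⟨
    ρ n * ((s n - b * (p₁ * - sgn (n ∸ n))) - 0ℚ) + 1ℚ ≡⟨ cong (λ u → ρ n * ((s n - u) - 0ℚ) + 1ℚ) (prev-alternating s (row (2 ℕ.* n)) b s-alternating ℕP.≤-refl) ⟨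
    ρ n * ((s n - prev s n) - 0ℚ) + 1ℚ                 ≡⟨ cong₂ (λ u v → ρ n * (u - v) + 1ℚ) (w-low ℕP.≤-refl) (w-high (ℕP.n<1+n n)) ⟨
    ρ n * (w n - w (suc n)) + 1ℚ                       ≡⟨ cong (λ v → ρ n * (w n - w (suc n)) + v) (coeff-mon 1ℚ (suc n)) ⟨
    ρ n * (prev w (suc n) - w (suc n)) + xⁿ⁺¹ (suc n)  ∎
    where
    open ≡-Reasoning
    p₁ = prev (row (2 ℕ.* n)) n
    lemma : ∀ b p → 1ℚ + b * p ≡ (1ℚ - b * (p * - 1ℚ)) - 0ℚ
    lemma = solve-∀ ℚ-ring

  recurrence-high : ∀ {j} → suc n < j → ℕ→ℚ 2 * s′ j ≡ ρ n * (prev w j - w j) + xⁿ⁺¹ j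
  recurrence-high {suc i} (s≤s n<i) = begin
    ℕ→ℚ 2 * s′ (suc i)                                ≡⟨ cong (ℕ→ℚ 2 *_) (coeff-𝒮-high (suc n) (suc n) (s≤s n<i)) ⟩
    ℕ→ℚ 2 * 0ℚ                                        ≡⟨ lemma (ρ n) ⟩
    ρ n * (0ℚ - 0ℚ) + 0ℚ                              ≡⟨ cong₂ (λ u v → ρ n * (u - v) + 0ℚ) (w-high n<i) (w-high (ℕP.m<n⇒m<1+n n<i)) ⟨
    ρ n * (w i - w (suc i)) + 0ℚ                      ≡⟨ cong (λ v → ρ n * (w i - w (suc i)) + v) (coeff-mon-≢ 1ℚ {suc n} {suc i} 1+n≢1+i) ⟨
    ρ n * (prev w (suc i) - w (suc i)) + xⁿ⁺¹ (suc i) ∎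
    where
    open ≡-Reasoning
    1+n≢1+i : suc n ≢ suc i
    1+n≢1+i 1+n≡1+i = ℕP.<-irrefl (ℕP.suc-injective 1+n≡1+i) n<i
    lemma : ∀ c → ℕ→ℚ 2 * 0ℚ ≡ c * (0ℚ - 0ℚ) + 0ℚ
    lemma = solve-∀ ℚ-ring

  recurrence-coeff : ∀ j → ℕ→ℚ 2 * s′ j ≡ ρ n * (prev w j - w j) + xⁿ⁺¹ j
  recurrence-coeff j = by-degree (ℕ.<-cmp j (suc n))
    where
    by-degree : Tri (j < suc n) (j ≡ suc n) (suc n < j) → ℕ→ℚ 2 * s′ j ≡ ρ n * (prev w j - w j) + xⁿ⁺¹ j
    by-degree (tri< j<1+n _ _) = recurrence-low (ℕP.≤-pred j<1+n)
    by-degree (tri≈ _ refl _)  = recurrence-next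
    by-degree (tri> _ _ 1+n<j) = recurrence-high 1+n<j

𝒮-recurrence : ∀ n → ℕ→ℚ 2 ·ₚ 𝒮 (suc n) (suc n) ≈ₚ ρ n ·ₚ ((X -ₚ constP 1ℚ) *ₚ (Xpow (suc n) -ₚ (X -ₚ constP 1ℚ) *ₚ 𝒮 n n)) +ₚ Xpow (suc n)
𝒮-recurrence n j = trans (coeff-·ₚ (ℕ→ℚ 2) (𝒮 (suc n) (suc n)) j) (trans (recurrence-coeff j) (sym (rhs≡ j)))
  where open Recurrence n

𝒮₁₁ : 𝒮 1 1 ≈ₚ X -ₚ constP ½
𝒮₁₁ zero          = refl
𝒮₁₁ (suc zero)    = refl
𝒮₁₁ (suc (suc j)) = refl

eval-𝒮-recurrence : ∀ n x → ℕ→ℚ 2 * eval (𝒮 (suc n) (suc n)) x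
                             ≡ ρ n * ((x - 1ℚ) * (x ^ suc n - (x - 1ℚ) * eval (𝒮 n n) x)) + x ^ suc n
eval-𝒮-recurrence n x = begin
  ℕ→ℚ 2 * eval (𝒮 (suc n) (suc n)) x                      ≡⟨ eval-·ₚ (ℕ→ℚ 2) (𝒮 (suc n) (suc n)) x ⟨
  eval (ℕ→ℚ 2 ·ₚ 𝒮 (suc n) (suc n)) x                     ≡⟨ eval-≈ₚ (ℕ→ℚ 2 ·ₚ 𝒮 (suc n) (suc n)) (ρ n ·ₚ ((X -ₚ constP 1ℚ) *ₚ W) +ₚ Xpow (suc n)) (𝒮-recurrence n) x ⟩
  eval (ρ n ·ₚ ((X -ₚ constP 1ℚ) *ₚ W) +ₚ Xpow (suc n)) x ≡⟨ eval-+ₚ (ρ n ·ₚ ((X -ₚ constP 1ℚ) *ₚ W)) (Xpow (suc n)) x ⟩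
  eval (ρ n ·ₚ ((X -ₚ constP 1ℚ) *ₚ W)) x + eval (Xpow (suc n)) x
    ≡⟨ cong₂ _+_ (trans (eval-·ₚ (ρ n) ((X -ₚ constP 1ℚ) *ₚ W) x) (cong (ρ n *_) (eval-*ₚ (X -ₚ constP 1ℚ) W x))) (eval-Xpow (suc n)) ⟩
  ρ n * (eval (X -ₚ constP 1ℚ) x * eval W x) + x ^ suc n                 ≡⟨ cong₂ (λ u v → ρ n * (u * v) + x ^ suc n) (eval-X-1 x) eval-W ⟩
  ρ n * ((x - 1ℚ) * (x ^ suc n - (x - 1ℚ) * eval (𝒮 n n) x)) + x ^ suc n ∎
  where
  open ≡-Reasoning
  open Recurrence n using (W)
  eval-Xpow : ∀ m → eval (Xpow m) x ≡ x ^ m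
  eval-Xpow m = trans (eval-mon 1ℚ m x) (ℚP.*-identityˡ (x ^ m))
  eval-W : eval W x ≡ x ^ suc n - (x - 1ℚ) * eval (𝒮 n n) x
  eval-W = trans (eval--ₚ (Xpow (suc n)) ((X -ₚ constP 1ℚ) *ₚ 𝒮 n n) x)
                 (cong₂ _-_ (eval-Xpow (suc n)) (trans (eval-*ₚ (X -ₚ constP 1ℚ) (𝒮 n n) x) (cong (_* eval (𝒮 n n) x) (eval-X-1 x))))

eval-𝒮₁₁ : ∀ x → eval (𝒮 1 1) x ≡ x - ½
eval-𝒮₁₁ x = trans (eval-≈ₚ (𝒮 1 1) (X -ₚ constP ½) 𝒮₁₁ x) (lemma x)
  where
  lemma : ∀ x → (0ℚ + - 1ℚ * ½) + x * (1ℚ + x * 0ℚ) ≡ x - ½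
  lemma = solve-∀ ℚ-ring

-- 2-adic integers and units

-- q ∈ ℤ₍₂₎, i.e. q = a / d with d odd (not necessarily in lowest terms)
record Integral₂ (q : ℚ) : Set where
  constructor integral₂
  field
    num : ℤ
    den : ℕ
    odd-den : Odd den
    q*den≡num : q * ℕ→ℚ den ≡ ℤ→ℚ num

-- q ∈ ℤ₍₂₎ˣ, i.e. q = a / d with a and d odd
record Unit₂ (q : ℚ) : Set where
  constructor unit₂
  field
    num : ℤ
    den : ℕ
    odd-den : Odd den
    odd-num : Odd ℤ.∣ num ∣
    q*den≡num : q * ℕ→ℚ den ≡ ℤ→ℚ num

unit₂⇒integral₂ : ∀ {q} → Unit₂ q → Integral₂ q
unit₂⇒integral₂ (unit₂ a d odd-d _ eq) = integral₂ a d odd-d eq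

integral₂-ℤ : ∀ a → Integral₂ (ℤ→ℚ a)
integral₂-ℤ a = integral₂ a 1 odd-1 (ℚP.*-identityʳ (ℤ→ℚ a))

unit₂-ℤ : ∀ {a} → Odd ℤ.∣ a ∣ → Unit₂ (ℤ→ℚ a)
unit₂-ℤ {a} odd-a = unit₂ a 1 odd-1 odd-a (ℚP.*-identityʳ (ℤ→ℚ a))

unit₂-invℕ : ∀ {d} → Odd d → Unit₂ (invℕ d)
unit₂-invℕ {d} odd-d = unit₂ (+ 1) d odd-d odd-1 (invℕ-inverseˡ d {{odd⇒nonZero odd-d}})

*-≡-ℤ→ℚ : ∀ p q a b d e → p * ℕ→ℚ d ≡ ℤ→ℚ a → q * ℕ→ℚ e ≡ ℤ→ℚ b → (p * q) * ℕ→ℚ (d ℕ.* e) ≡ ℤ→ℚ (a ℤ.* b)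
*-≡-ℤ→ℚ p q a b d e pd≡a qe≡b = begin
  (p * q) * ℕ→ℚ (d ℕ.* e)   ≡⟨ cong ((p * q) *_) (ℕ→ℚ-* d e) ⟩
  (p * q) * (ℕ→ℚ d * ℕ→ℚ e) ≡⟨ regroup p q (ℕ→ℚ d) (ℕ→ℚ e) ⟩
  (p * ℕ→ℚ d) * (q * ℕ→ℚ e) ≡⟨ cong₂ _*_ pd≡a qe≡b ⟩
  ℤ→ℚ a * ℤ→ℚ b             ≡⟨ ℤ→ℚ-* a b ⟨
  ℤ→ℚ (a ℤ.* b)             ∎
  where
  open ≡-Reasoning
  regroup : ∀ p q d e → (p * q) * (d * e) ≡ (p * d) * (q * e)
  regroup = solve-∀ ℚ-ring

integral₂-* : ∀ {p q} → Integral₂ p → Integral₂ q → Integral₂ (p * q)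
integral₂-* {p} {q} (integral₂ a d odd-d pd≡a) (integral₂ b e odd-e qe≡b) =
  integral₂ (a ℤ.* b) (d ℕ.* e) (odd-* odd-d odd-e) (*-≡-ℤ→ℚ p q a b d e pd≡a qe≡b)

unit₂-* : ∀ {p q} → Unit₂ p → Unit₂ q → Unit₂ (p * q)
unit₂-* {p} {q} (unit₂ a d odd-d odd-a pd≡a) (unit₂ b e odd-e odd-b qe≡b) =
  unit₂ (a ℤ.* b) (d ℕ.* e) (odd-* odd-d odd-e) (odd-∣*∣ {a} {b} odd-a odd-b) (*-≡-ℤ→ℚ p q a b d e pd≡a qe≡b)

-‿≡-ℤ→ℚ : ∀ p a d → p * ℕ→ℚ d ≡ ℤ→ℚ a → - p * ℕ→ℚ d ≡ ℤ→ℚ (ℤ.- a)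
-‿≡-ℤ→ℚ p a d pd≡a = trans (sym (ℚP.neg-distribˡ-* p (ℕ→ℚ d))) (trans (cong -_ pd≡a) (sym (ℤ→ℚ-neg a)))

integral₂-neg : ∀ {p} → Integral₂ p → Integral₂ (- p)
integral₂-neg {p} (integral₂ a d odd-d pd≡a) = integral₂ (ℤ.- a) d odd-d (-‿≡-ℤ→ℚ p a d pd≡a)

unit₂-neg : ∀ {p} → Unit₂ p → Unit₂ (- p)
unit₂-neg {p} (unit₂ a d odd-d odd-a pd≡a) = unit₂ (ℤ.- a) d odd-d (odd-∣-∣ {a} odd-a) (-‿≡-ℤ→ℚ p a d pd≡a)

+-≡-ℤ→ℚ : ∀ p q a b d e (c : ℤ) → p * ℕ→ℚ d ≡ ℤ→ℚ a → q * ℕ→ℚ e ≡ ℤ→ℚ b →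
           (p + ℤ→ℚ c * q) * ℕ→ℚ (d ℕ.* e) ≡ ℤ→ℚ (a ℤ.* + e ℤ.+ c ℤ.* (b ℤ.* + d))
+-≡-ℤ→ℚ p q a b d e c pd≡a qe≡b = begin
  (p + ℤ→ℚ c * q) * ℕ→ℚ (d ℕ.* e)                     ≡⟨ cong ((p + ℤ→ℚ c * q) *_) (ℕ→ℚ-* d e) ⟩
  (p + ℤ→ℚ c * q) * (ℕ→ℚ d * ℕ→ℚ e)                   ≡⟨ regroup p q (ℤ→ℚ c) (ℕ→ℚ d) (ℕ→ℚ e) ⟩
  (p * ℕ→ℚ d) * ℕ→ℚ e + ℤ→ℚ c * ((q * ℕ→ℚ e) * ℕ→ℚ d) ≡⟨ cong₂ (λ u v → u * ℕ→ℚ e + ℤ→ℚ c * (v * ℕ→ℚ d)) pd≡a qe≡b ⟩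
  ℤ→ℚ a * ℤ→ℚ (+ e) + ℤ→ℚ c * (ℤ→ℚ b * ℤ→ℚ (+ d))     ≡⟨ cong₂ (λ u v → u + ℤ→ℚ c * v) (ℤ→ℚ-* a (+ e)) (ℤ→ℚ-* b (+ d)) ⟨
  ℤ→ℚ (a ℤ.* + e) + ℤ→ℚ c * ℤ→ℚ (b ℤ.* + d)           ≡⟨ cong (λ v → ℤ→ℚ (a ℤ.* + e) + v) (ℤ→ℚ-* c (b ℤ.* + d)) ⟨
  ℤ→ℚ (a ℤ.* + e) + ℤ→ℚ (c ℤ.* (b ℤ.* + d))           ≡⟨ ℤ→ℚ-+ (a ℤ.* + e) (c ℤ.* (b ℤ.* + d)) ⟨
  ℤ→ℚ (a ℤ.* + e ℤ.+ c ℤ.* (b ℤ.* + d))               ∎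
  where
  open ≡-Reasoning
  regroup : ∀ p q c d e → (p + c * q) * (d * e) ≡ (p * d) * e + c * ((q * e) * d)
  regroup = solve-∀ ℚ-ring

integral₂-+ : ∀ {p q} → Integral₂ p → Integral₂ q → Integral₂ (p + q)
integral₂-+ {p} {q} (integral₂ a d odd-d pd≡a) (integral₂ b e odd-e qe≡b) =
  integral₂ (a ℤ.* + e ℤ.+ + 1 ℤ.* (b ℤ.* + d)) (d ℕ.* e) (odd-* odd-d odd-e) (subst (λ r → (p + r) * ℕ→ℚ (d ℕ.* e) ≡ _) (ℚP.*-identityˡ q) (+-≡-ℤ→ℚ p q a b d e (+ 1) pd≡a qe≡b))

unit₂-+2* : ∀ {p q} → Unit₂ p → Integral₂ q → Unit₂ (p + ℕ→ℚ 2 * q)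
unit₂-+2* {p} {q} (unit₂ a d odd-d odd-a pd≡a) (integral₂ b e odd-e qe≡b) =
  unit₂ (a ℤ.* + e ℤ.+ + 2 ℤ.* (b ℤ.* + d)) (d ℕ.* e) (odd-* odd-d odd-e) (odd-∣+2*∣ {a ℤ.* + e} (odd-∣*∣ {a} {+ e} odd-a odd-e) (b ℤ.* + d)) (+-≡-ℤ→ℚ p q a b d e (+ 2) pd≡a qe≡b)

integral₂-^ : ∀ {x} → Integral₂ x → ∀ m → Integral₂ (x ^ m)
integral₂-^ _   zero    = integral₂-ℤ (+ 1)
integral₂-^ i-x (suc m) = integral₂-* i-x (integral₂-^ i-x m)

unit₂-^ : ∀ {x} → Unit₂ x → ∀ m → Unit₂ (x ^ m)
unit₂-^ _   zero    = unit₂-ℤ {+ 1} odd-1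
unit₂-^ u-x (suc m) = unit₂-* u-x (unit₂-^ u-x m)

ℤ→ℚ-+m*z*+d : ∀ m z d → ℤ→ℚ (+ m ℤ.* z ℤ.* + d) ≡ ℕ→ℚ m * ℤ→ℚ z * ℕ→ℚ d
ℤ→ℚ-+m*z*+d m z d = trans (ℤ→ℚ-* (+ m ℤ.* z) (+ d)) (cong (_* ℕ→ℚ d) (ℤ→ℚ-* (+ m) z))

∣+m*z*+d∣ : ∀ m z d → ℤ.∣ + m ℤ.* z ℤ.* + d ∣ ≡ m ℕ.* ℤ.∣ z ∣ ℕ.* d
∣+m*z*+d∣ m z d = trans (ℤP.abs-* (+ m ℤ.* z) (+ d)) (cong (ℕ._* d) (ℤP.abs-* (+ m) z))

unit₂-2^e*q⇒Ord₂-denom : ∀ e q → Unit₂ (ℕ→ℚ (2 ℕ.^ e) * q) → Ord₂ (denom q) e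
unit₂-2^e*q⇒Ord₂-denom e q@(ℚ.mkℚ N _ coprime) (unit₂ a d odd-d odd-a 2^eqd≡a) =
  Ord₂-from-cross e odd-a odd-d (trans (sym (∣+m*z*+d∣ (2 ℕ.^ e) N d)) (trans (cong ℤ.∣_∣ (ℤ→ℚ-injective {+ (2 ℕ.^ e) ℤ.* N ℤ.* + d} {a ℤ.* + D} cross)) (ℤP.abs-* a (+ D))))
    (recompute coprime)
  where
  open ≡-Reasoning
  D = denom q
  cross : ℤ→ℚ (+ (2 ℕ.^ e) ℤ.* N ℤ.* + d) ≡ ℤ→ℚ (a ℤ.* + D)
  cross = begin
    ℤ→ℚ (+ (2 ℕ.^ e) ℤ.* N ℤ.* + d)     ≡⟨ ℤ→ℚ-+m*z*+d (2 ℕ.^ e) N d ⟩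
    ℕ→ℚ (2 ℕ.^ e) * ℤ→ℚ N * ℕ→ℚ d       ≡⟨ cong (λ u → ℕ→ℚ (2 ℕ.^ e) * u * ℕ→ℚ d) (*↧≡↥ q) ⟨
    ℕ→ℚ (2 ℕ.^ e) * (q * ℕ→ℚ D) * ℕ→ℚ d ≡⟨ regroup (ℕ→ℚ (2 ℕ.^ e)) q (ℕ→ℚ D) (ℕ→ℚ d) ⟩
    ℕ→ℚ (2 ℕ.^ e) * q * ℕ→ℚ d * ℕ→ℚ D   ≡⟨ cong (_* ℕ→ℚ D) 2^eqd≡a ⟩
    ℤ→ℚ a * ℕ→ℚ D                       ≡⟨ ℤ→ℚ-* a (+ D) ⟨
    ℤ→ℚ (a ℤ.* + D)                     ∎
    where
    regroup : ∀ p q D d → p * (q * D) * d ≡ p * q * d * D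
    regroup = solve-∀ ℚ-ring

unit₂-2^e*q⇒non-integral : ∀ e q → 1 ℕ.≤ e → Unit₂ (ℕ→ℚ (2 ℕ.^ e) * q) → ¬ ∃ λ (z : ℤ) → q ≡ ℤ→ℚ z
unit₂-2^e*q⇒non-integral (suc e) _ _ (unit₂ a d odd-d odd-a 2^[1+e]zd≡a) (z , refl) =
  odd-a (divides (2 ℕ.^ e ℕ.* ℤ.∣ z ∣ ℕ.* d) (begin
    ℤ.∣ a ∣                             ≡⟨ cong ℤ.∣_∣ (ℤ→ℚ-injective {a} {+ (2 ℕ.^ suc e) ℤ.* z ℤ.* + d} (trans (sym 2^[1+e]zd≡a) (sym (ℤ→ℚ-+m*z*+d (2 ℕ.^ suc e) z d)))) ⟩
    ℤ.∣ + (2 ℕ.^ suc e) ℤ.* z ℤ.* + d ∣ ≡⟨ ∣+m*z*+d∣ (2 ℕ.^ suc e) z d ⟩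
    2 ℕ.^ suc e ℕ.* ℤ.∣ z ∣ ℕ.* d       ≡⟨ regroup (2 ℕ.^ e) ℤ.∣ z ∣ d ⟩
    2 ℕ.^ e ℕ.* ℤ.∣ z ∣ ℕ.* d ℕ.* 2     ∎))
  where
  open ≡-Reasoning
  regroup : ∀ p z d → 2 ℕ.* p ℕ.* z ℕ.* d ≡ p ℕ.* z ℕ.* d ℕ.* 2
  regroup = ℕRing.solve-∀

-- 2-adic behaviour of S_{n,n} at integers

integral₂-ρ : ∀ n → Integral₂ (ρ n)
integral₂-ρ n = integral₂ (+ suc n) (suc (2 ℕ.* n)) (odd-2n+1 n) (begin
  ρ n * ℕ→ℚ (suc (2 ℕ.* n))                                  ≡⟨ cong (_* ℕ→ℚ (suc (2 ℕ.* n))) (/-≡-*invℕ (suc n) (2 ℕ.* n)) ⟩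
  ℕ→ℚ (suc n) * invℕ (suc (2 ℕ.* n)) * ℕ→ℚ (suc (2 ℕ.* n))   ≡⟨ ℚP.*-assoc (ℕ→ℚ (suc n)) _ _ ⟩
  ℕ→ℚ (suc n) * (invℕ (suc (2 ℕ.* n)) * ℕ→ℚ (suc (2 ℕ.* n))) ≡⟨ cong (ℕ→ℚ (suc n) *_) (invℕ-inverseˡ (suc (2 ℕ.* n))) ⟩
  ℕ→ℚ (suc n) * 1ℚ                                           ≡⟨ ℚP.*-identityʳ (ℕ→ℚ (suc n)) ⟩
  ℕ→ℚ (suc n)                                                ∎)
  where open ≡-Reasoning

unit₂-2*𝒮₁₁ : ∀ ℓ → Unit₂ (ℕ→ℚ 2 * eval (𝒮 1 1) (ℤ→ℚ ℓ))
unit₂-2*𝒮₁₁ ℓ = subst Unit₂ (sym 2[x-½]≡-1+2x) (unit₂-+2* (unit₂-ℤ { -[1+ 0 ]} odd-1) (integral₂-ℤ ℓ))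
  where
  2[x-½]≡-1+2x : ℕ→ℚ 2 * eval (𝒮 1 1) (ℤ→ℚ ℓ) ≡ ℤ→ℚ -[1+ 0 ] + ℕ→ℚ 2 * ℤ→ℚ ℓ
  2[x-½]≡-1+2x = trans (cong (ℕ→ℚ 2 *_) (eval-𝒮₁₁ (ℤ→ℚ ℓ))) (lemma (ℤ→ℚ ℓ))
    where
    lemma : ∀ x → ℕ→ℚ 2 * (x - ½) ≡ ℤ→ℚ -[1+ 0 ] + ℕ→ℚ 2 * x
    lemma = solve-∀ ℚ-ring

module Odd-point (x K : ℚ) (x-1≡2K : x - 1ℚ ≡ ℕ→ℚ 2 * K) (integral₂-K : Integral₂ K) (unit₂-x : Unit₂ x) where

  2*𝒮[2+n]≡ : ∀ n → ℕ→ℚ 2 * eval (𝒮 (suc (suc n)) (suc (suc n))) x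
               ≡ x ^ suc (suc n) + ℕ→ℚ 2 * (ρ (suc n) * (K * (x ^ suc (suc n) - K * (ℕ→ℚ 2 * eval (𝒮 (suc n) (suc n)) x))))
  2*𝒮[2+n]≡ n = begin
    ℕ→ℚ 2 * eval (𝒮 (suc (suc n)) (suc (suc n))) x        ≡⟨ eval-𝒮-recurrence (suc n) x ⟩
    ρ (suc n) * ((x - 1ℚ) * (P - (x - 1ℚ) * v)) + P       ≡⟨ cong (λ y → ρ (suc n) * (y * (P - y * v)) + P) x-1≡2K ⟩
    ρ (suc n) * ((ℕ→ℚ 2 * K) * (P - (ℕ→ℚ 2 * K) * v)) + P ≡⟨ lemma (ρ (suc n)) K P v ⟩
    P + ℕ→ℚ 2 * (ρ (suc n) * (K * (P - K * (ℕ→ℚ 2 * v)))) ∎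
    where
    open ≡-Reasoning
    P = x ^ suc (suc n)
    v = eval (𝒮 (suc n) (suc n)) x
    lemma : ∀ c K P v → c * ((ℕ→ℚ 2 * K) * (P - (ℕ→ℚ 2 * K) * v)) + P ≡ P + ℕ→ℚ 2 * (c * (K * (P - K * (ℕ→ℚ 2 * v))))
    lemma = solve-∀ ℚ-ring

  unit₂-2*𝒮 : ∀ n → Unit₂ (ℕ→ℚ 2 * eval (𝒮 (suc n) (suc n)) x) → Unit₂ (ℕ→ℚ 2 * eval (𝒮 (suc (suc n)) (suc (suc n))) x)
  unit₂-2*𝒮 n u = subst Unit₂ (sym (2*𝒮[2+n]≡ n))
    (unit₂-+2* (unit₂-^ unit₂-x (suc (suc n)))
      (integral₂-* (integral₂-ρ (suc n)) (integral₂-* integral₂-K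
        (integral₂-+ (integral₂-^ (unit₂⇒integral₂ unit₂-x) (suc (suc n))) (integral₂-neg (integral₂-* integral₂-K (unit₂⇒integral₂ u)))))))

-- The recurrence at x = 2K, multiplied by P′ = 2^{s₂(n+1)} and rewritten with P′·(n+1) = P·2·o
-- where P = 2^{s₂ n}: the right-hand side is a 2-adic unit plus twice a 2-adic integer.
even-step-identity : ∀ {x K P P′ O N₁ i v v′} m → x ≡ ℕ→ℚ 2 * K → P′ * N₁ ≡ P * ℕ→ℚ 2 * O →
  ℕ→ℚ 2 * v′ ≡ N₁ * i * ((x - 1ℚ) * (x ^ suc (suc m) - (x - 1ℚ) * v)) + x ^ suc (suc m) →
  (P′ * v′) * N₁ ≡ (O * i * (x - 1ℚ) * (- ((x - 1ℚ) * (P * v)) + ℕ→ℚ 2 * (P * K * x ^ suc m)) + ℕ→ℚ 2 * (P′ * K * K * x ^ m)) * N₁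
even-step-identity {K = K} {P} {P′} {O} {N₁} {i} {v} {v′} m refl hP hrec = begin
  (P′ * v′) * N₁       ≡⟨ regroup₁ P′ v′ N₁ ⟩
  v′ * (P′ * N₁)       ≡⟨ cong (v′ *_) hP ⟩
  v′ * (P * ℕ→ℚ 2 * O) ≡⟨ regroup₂ v′ P O ⟩
  P * O * (ℕ→ℚ 2 * v′) ≡⟨ cong (P * O *_) hrec ⟩
  P * O * (N₁ * i * ((x - 1ℚ) * (x ^ suc (suc m) - (x - 1ℚ) * v)) + x ^ suc (suc m))
                                                   ≡⟨ regroup₃ K v P O N₁ i (x ^ m) ⟩
  T * N₁ + ℕ→ℚ 2 * K * K * x ^ m * (P * ℕ→ℚ 2 * O) ≡⟨ cong (λ u → T * N₁ + ℕ→ℚ 2 * K * K * x ^ m * u) hP ⟨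
  T * N₁ + ℕ→ℚ 2 * K * K * x ^ m * (P′ * N₁)       ≡⟨ regroup₄ T K (x ^ m) P′ N₁ ⟩
  (T + ℕ→ℚ 2 * (P′ * K * K * x ^ m)) * N₁          ∎
  where
  open ≡-Reasoning
  x = ℕ→ℚ 2 * K
  T = O * i * (x - 1ℚ) * (- ((x - 1ℚ) * (P * v)) + ℕ→ℚ 2 * (P * K * x ^ suc m))
  regroup₁ : ∀ a b c → (a * b) * c ≡ b * (a * c)
  regroup₁ = solve-∀ ℚ-ring
  regroup₂ : ∀ v P O → v * (P * ℕ→ℚ 2 * O) ≡ P * O * (ℕ→ℚ 2 * v)
  regroup₂ = solve-∀ ℚ-ring
  regroup₃ : ∀ K v P O N₁ i y → let x = ℕ→ℚ 2 * K in
    P * O * (N₁ * i * ((x - 1ℚ) * (x * (x * y) - (x - 1ℚ) * v)) + x * (x * y))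
    ≡ O * i * (x - 1ℚ) * (- ((x - 1ℚ) * (P * v)) + ℕ→ℚ 2 * (P * K * (x * y))) * N₁ + ℕ→ℚ 2 * K * K * y * (P * ℕ→ℚ 2 * O)
  regroup₃ = solve-∀ ℚ-ring
  regroup₄ : ∀ T K y P′ N₁ → T * N₁ + ℕ→ℚ 2 * K * K * y * (P′ * N₁) ≡ (T + ℕ→ℚ 2 * (P′ * K * K * y)) * N₁
  regroup₄ = solve-∀ ℚ-ring

module Even-point (x K : ℚ) (x≡2K : x ≡ ℕ→ℚ 2 * K) (integral₂-K : Integral₂ K) where

  unit₂-x-1 : Unit₂ (x - 1ℚ)
  unit₂-x-1 = subst Unit₂ (sym x-1≡-1+2K) (unit₂-+2* (unit₂-ℤ { -[1+ 0 ]} odd-1) integral₂-K)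
    where
    x-1≡-1+2K : x - 1ℚ ≡ ℤ→ℚ -[1+ 0 ] + ℕ→ℚ 2 * K
    x-1≡-1+2K = trans (cong (_- 1ℚ) x≡2K) (lemma K)
      where
      lemma : ∀ K → ℕ→ℚ 2 * K - 1ℚ ≡ ℤ→ℚ -[1+ 0 ] + ℕ→ℚ 2 * K
      lemma = solve-∀ ℚ-ring


  unit₂-2^s₂*𝒮 : ∀ m → Unit₂ (ℕ→ℚ (2 ℕ.^ s₂ (suc m)) * eval (𝒮 (suc m) (suc m)) x)
                      → Unit₂ (ℕ→ℚ (2 ℕ.^ s₂ (suc (suc m))) * eval (𝒮 (suc (suc m)) (suc (suc m))) x)
  unit₂-2^s₂*𝒮 m u = subst Unit₂ (sym P′v′≡) (unit₂-+2* unit₂-T integral₂-P′KKxᵐ)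
    where
    n = suc m
    o = proj₁ (2^s₂n*2*odd≡2^s₂[1+n]*[1+n] n)
    odd-o = proj₁ (proj₂ (2^s₂n*2*odd≡2^s₂[1+n]*[1+n] n))
    2^s₂n*2*o≡ = proj₂ (proj₂ (2^s₂n*2*odd≡2^s₂[1+n]*[1+n] n))
    P  = ℕ→ℚ (2 ℕ.^ s₂ n)
    P′ = ℕ→ℚ (2 ℕ.^ s₂ (suc n))
    i  = invℕ (suc (2 ℕ.* n))
    v  = eval (𝒮 n n) x
    v′ = eval (𝒮 (suc n) (suc n)) x
    T  = ℕ→ℚ o * i * (x - 1ℚ) * (- ((x - 1ℚ) * (P * v)) + ℕ→ℚ 2 * (P * K * x ^ n))
    hP : P′ * ℕ→ℚ (suc n) ≡ P * ℕ→ℚ 2 * ℕ→ℚ o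
    hP = begin
      P′ * ℕ→ℚ (suc n)                 ≡⟨ ℕ→ℚ-* (2 ℕ.^ s₂ (suc n)) (suc n) ⟨
      ℕ→ℚ (2 ℕ.^ s₂ (suc n) ℕ.* suc n) ≡⟨ cong ℕ→ℚ 2^s₂n*2*o≡ ⟨
      ℕ→ℚ (2 ℕ.^ s₂ n ℕ.* 2 ℕ.* o)     ≡⟨ trans (ℕ→ℚ-* (2 ℕ.^ s₂ n ℕ.* 2) o) (cong (_* ℕ→ℚ o) (ℕ→ℚ-* (2 ℕ.^ s₂ n) 2)) ⟩
      P * ℕ→ℚ 2 * ℕ→ℚ o                ∎
      where open ≡-Reasoning
    P′v′≡ : P′ * v′ ≡ T + ℕ→ℚ 2 * (P′ * K * K * x ^ m)
    P′v′≡ = *-cancelʳ-ℕ→ℚ (suc n) (even-step-identity {x} {K} {P} {P′} {ℕ→ℚ o} {ℕ→ℚ (suc n)} {i} {v} {v′} m x≡2K hP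
      (subst (λ c → ℕ→ℚ 2 * v′ ≡ c * ((x - 1ℚ) * (x ^ suc n - (x - 1ℚ) * v)) + x ^ suc n) (/-≡-*invℕ (suc n) (2 ℕ.* n)) (eval-𝒮-recurrence n x)))
    integral₂-x : Integral₂ x
    integral₂-x = subst Integral₂ (sym x≡2K) (integral₂-* (integral₂-ℤ (+ 2)) integral₂-K)
    integral₂-2^ : ∀ e → Integral₂ (ℕ→ℚ (2 ℕ.^ e))
    integral₂-2^ e = integral₂-ℤ (+ (2 ℕ.^ e))
    unit₂-T : Unit₂ T
    unit₂-T = unit₂-* (unit₂-* (unit₂-* (unit₂-ℤ {+ o} odd-o) (unit₂-invℕ (odd-2n+1 n))) unit₂-x-1)
                (unit₂-+2* (unit₂-neg (unit₂-* unit₂-x-1 u))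
                           (integral₂-* (integral₂-* (integral₂-2^ (s₂ n)) integral₂-K) (integral₂-^ integral₂-x n)))
    integral₂-P′KKxᵐ : Integral₂ (P′ * K * K * x ^ m)
    integral₂-P′KKxᵐ = integral₂-* (integral₂-* (integral₂-* (integral₂-2^ (s₂ (suc n))) integral₂-K) integral₂-K) (integral₂-^ integral₂-x m)

even⇒ℤ→ℚ≡2* : ∀ ℓ → (+ 2) ℤD.∣ ℓ → ∃ λ k → ℤ→ℚ ℓ ≡ ℕ→ℚ 2 * ℤ→ℚ k
even⇒ℤ→ℚ≡2* ℓ 2∣ℓ with ℤS.∣ᵤ⇒∣ {+ 2} {ℓ} 2∣ℓ
... | ℤS.divides k ℓ≡k*2 = k , trans (cong ℤ→ℚ ℓ≡k*2) (trans (ℤ→ℚ-* k (+ 2)) (ℚP.*-comm (ℤ→ℚ k) (ℕ→ℚ 2)))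

odd⇒ℤ→ℚ-1≡2* : ∀ ℓ → ¬ (+ 2) ℤD.∣ ℓ → ∃ λ k → ℤ→ℚ ℓ - 1ℚ ≡ ℕ→ℚ 2 * ℤ→ℚ k
odd⇒ℤ→ℚ-1≡2* ℓ 2∤ℓ = by-remainder (ℓ ℤM.% + 2) (ℤM.n%d<d ℓ (+ 2)) (ℤM.a≡a%n+[a/n]*n ℓ (+ 2))
  where
  q = ℓ ℤM./ + 2
  by-remainder : ∀ r → r ℕ.< 2 → ℓ ≡ + r ℤ.+ q ℤ.* + 2 → ∃ λ k → ℤ→ℚ ℓ - 1ℚ ≡ ℕ→ℚ 2 * ℤ→ℚ k
  by-remainder zero          _                 ℓ≡2q   = contradiction (ℤS.∣⇒∣ᵤ {+ 2} {ℓ} (ℤS.divides q (trans ℓ≡2q (ℤP.+-identityˡ (q ℤ.* + 2))))) 2∤ℓ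
  by-remainder (suc zero)    _                 ℓ≡1+2q = q , (begin
    ℤ→ℚ ℓ - 1ℚ                   ≡⟨ cong (λ z → ℤ→ℚ z - 1ℚ) ℓ≡1+2q ⟩
    ℤ→ℚ (+ 1 ℤ.+ q ℤ.* + 2) - 1ℚ ≡⟨ cong (_- 1ℚ) (trans (ℤ→ℚ-+ (+ 1) (q ℤ.* + 2)) (cong (λ u → 1ℚ + u) (ℤ→ℚ-* q (+ 2)))) ⟩
    1ℚ + ℤ→ℚ q * ℕ→ℚ 2 - 1ℚ      ≡⟨ lemma (ℤ→ℚ q) ⟩
    ℕ→ℚ 2 * ℤ→ℚ q                ∎)
    where
    open ≡-Reasoning
    lemma : ∀ k → 1ℚ + k * ℕ→ℚ 2 - 1ℚ ≡ ℕ→ℚ 2 * k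
    lemma = solve-∀ ℚ-ring
  by-remainder (suc (suc _)) (s≤s (s≤s ()))   _

unit₂-2*𝒮-at-odd : ∀ ℓ → ¬ (+ 2) ℤD.∣ ℓ → ∀ m → Unit₂ (ℕ→ℚ 2 * eval (𝒮 (suc m) (suc m)) (ℤ→ℚ ℓ))
unit₂-2*𝒮-at-odd ℓ 2∤ℓ zero    = unit₂-2*𝒮₁₁ ℓ
unit₂-2*𝒮-at-odd ℓ 2∤ℓ (suc m) =
  Odd-point.unit₂-2*𝒮 (ℤ→ℚ ℓ) (ℤ→ℚ k) x-1≡2k (integral₂-ℤ k) (unit₂-ℤ {ℓ} 2∤ℓ) m (unit₂-2*𝒮-at-odd ℓ 2∤ℓ m)
  where
  k = proj₁ (odd⇒ℤ→ℚ-1≡2* ℓ 2∤ℓ)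
  x-1≡2k = proj₂ (odd⇒ℤ→ℚ-1≡2* ℓ 2∤ℓ)

unit₂-2^s₂*𝒮-at-even : ∀ ℓ → (+ 2) ℤD.∣ ℓ → ∀ m → Unit₂ (ℕ→ℚ (2 ℕ.^ s₂ (suc m)) * eval (𝒮 (suc m) (suc m)) (ℤ→ℚ ℓ))
unit₂-2^s₂*𝒮-at-even ℓ 2∣ℓ zero    = unit₂-2*𝒮₁₁ ℓ   -- 2 ^ s₂ 1 reduces to 2
unit₂-2^s₂*𝒮-at-even ℓ 2∣ℓ (suc m) =
  Even-point.unit₂-2^s₂*𝒮 (ℤ→ℚ ℓ) (ℤ→ℚ k) x≡2k (integral₂-ℤ k) m (unit₂-2^s₂*𝒮-at-even ℓ 2∣ℓ m)
  where
  k = proj₁ (even⇒ℤ→ℚ≡2* ℓ 2∣ℓ)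
  x≡2k = proj₂ (even⇒ℤ→ℚ≡2* ℓ 2∣ℓ)

theorem3p4 : (n : ℕ) → 1 ≤ n →
  (𝒮 n n ≈ₚ invℕ ((2 ℕ.* n) C n) ·ₚ sumP (λ k → mon (ℕ→ℚ ((2 ℕ.* n) C k) ℚ.* sgn (n ∸ k)) k) (suc n))
  × ((ℕ→ℚ 2) ·ₚ 𝒮 (suc n) (suc n) ≈ₚ ((+ suc n) ℚ./ suc (2 ℕ.* n)) ·ₚ ((X -ₚ constP 1ℚ) *ₚ (Xpow (suc n) -ₚ (X -ₚ constP 1ℚ) *ₚ 𝒮 n n)) +ₚ Xpow (suc n))
  × (𝒮 1 1 ≈ₚ X -ₚ constP ½)
  × ((ℓ : ℤ) → ¬ (∃ λ (z : ℤ) → eval (𝒮 n n) (ℤ→ℚ ℓ) ≡ ℤ→ℚ z))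
  × ((ℓ : ℤ) → ¬ ((+ 2) ℤD.∣ ℓ) → Ord₂ (denom (eval (𝒮 n n) (ℤ→ℚ ℓ))) 1)
  × ((ℓ : ℤ) → (+ 2) ℤD.∣ ℓ → Ord₂ (denom (eval (𝒮 n n) (ℤ→ℚ ℓ))) (s₂ n))
theorem3p4 n@(suc m) _ = 𝒮-diagonal-closed-form n , 𝒮-recurrence n , 𝒮₁₁ , non-integral , ord₂-at-odd , ord₂-at-even
  where
  non-integral : ∀ ℓ → ¬ ∃ λ (z : ℤ) → eval (𝒮 n n) (ℤ→ℚ ℓ) ≡ ℤ→ℚ z
  non-integral ℓ = by-parity (2 ∣? ℤ.∣ ℓ ∣)
    where
    by-parity : Dec ((+ 2) ℤD.∣ ℓ) → ¬ ∃ λ (z : ℤ) → eval (𝒮 n n) (ℤ→ℚ ℓ) ≡ ℤ→ℚ z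
    by-parity (yes 2∣ℓ) = unit₂-2^e*q⇒non-integral (s₂ n) (eval (𝒮 n n) (ℤ→ℚ ℓ)) (1≤s₂ {n} λ ()) (unit₂-2^s₂*𝒮-at-even ℓ 2∣ℓ m)
    by-parity (no 2∤ℓ)  = unit₂-2^e*q⇒non-integral 1 (eval (𝒮 n n) (ℤ→ℚ ℓ)) (s≤s z≤n) (unit₂-2*𝒮-at-odd ℓ 2∤ℓ m)
  ord₂-at-odd : ∀ ℓ → ¬ (+ 2) ℤD.∣ ℓ → Ord₂ (denom (eval (𝒮 n n) (ℤ→ℚ ℓ))) 1
  ord₂-at-odd ℓ 2∤ℓ = unit₂-2^e*q⇒Ord₂-denom 1 (eval (𝒮 n n) (ℤ→ℚ ℓ)) (unit₂-2*𝒮-at-odd ℓ 2∤ℓ m)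
  ord₂-at-even : ∀ ℓ → (+ 2) ℤD.∣ ℓ → Ord₂ (denom (eval (𝒮 n n) (ℤ→ℚ ℓ))) (s₂ n)
  ord₂-at-even ℓ 2∣ℓ = unit₂-2^e*q⇒Ord₂-denom (s₂ n) (eval (𝒮 n n) (ℤ→ℚ ℓ)) (unit₂-2^s₂*𝒮-at-even ℓ 2∣ℓ m)
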